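{- Let $G$ be a connected graph with $n$ vertices. Then $l(G)=2$ if and only if $G$ is isomorphic to $Q_n$ (with $n\ge3$) or to $R_n$ (with $n\ge 4$).
   Context: For $a\neq b$ in $\{1,\ldots,n\}$, $(a\to b)$ denotes the transformation mapping $a$ to $b$ and fixing every other point; transformations are composed left to right. For a digraph $D$ on $\{1,\ldots,n\}$ (no loops, no multiple arcs), $\langle D\rangle$ is the semigroup generated by all $(a\to b)$ with $(a,b)$ an arc. A graph is a digraph in which $(u,v)$ is an arc iff $(v,u)$ is. A cycle of length $k$ of a transformation $\alpha$ is a sequence of distinct points $a_0,\ldots,a_{k-1}$ with $a_i\alpha=a_{i+1}$ (indices mod $k$); $l(\alpha)$ is the length of a longest cycle of $\alpha$, and $l(D)=\max\{l(\alpha):\alpha\in\langle D\rangle\}$. The path graph $P_n$ has vertices $1,\ldots,n$ and edges $\{i,i+1\}$, $1\le i\le n-1$. For $n\ge3$, $Q_n$ is $P_n$ with the additional edge $\{n-2,n\}$. For $n\ge 4$, $R_n$ is $Q_n$ with the edge $\{n-1,n\}$ removed. -}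

module Defs where

open import Data.Nat using (ℕ; zero; suc; _≤_; _∸_)
open import Data.Nat.DivMod using (_mod_)
open import Data.Fin using (Fin; toℕ; _≟_)
open import Data.Bool using (Bool; true; false; if_then_else_; _∨_; _∧_; not)
open import Data.Product using (Σ; _×_; ∃)
open import Function using (Injective)
open import Function.Bundles using (_↔_; Inverse)
open import Relation.Nullary.Decidable using (⌊_⌋)
open import Relation.Binary.PropositionalEquality using (_≡_)
import Data.Nat as ℕ

-- A (simple) graph on the vertex set Fin n (vertex i ∈ Fin n is the
-- paper's vertex toℕ i + 1): symmetric, loopless adjacency.
record Graph (n : ℕ) : Set where
  field
    adj   : Fin n → Fin n → Bool
    sym   : ∀ u v → adj u v ≡ adj v u
    loopless : ∀ u → adj u u ≡ false
open Graph public

Arc : ∀ {n} → Graph n → Fin n → Fin n → Set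
Arc G a b = adj G a b ≡ true

Transf : ℕ → Set
Transf n = Fin n → Fin n

[_↦_] : ∀ {n} → Fin n → Fin n → Transf n
[ a ↦ b ] x = if ⌊ x ≟ a ⌋ then b else x

-- left-to-right composition: x (α β) = (x α) β
_⨟_ : ∀ {n} → Transf n → Transf n → Transf n
(α ⨟ β) x = β (α x)

data InSG {n : ℕ} (G : Graph n) : Transf n → Set where
  gen  : ∀ {a b} → Arc G a b → InSG G [ a ↦ b ]
  comp : ∀ {α β} → InSG G α → InSG G β → InSG G (α ⨟ β)

HasCycle : ∀ {n} → Transf n → ℕ → Set
HasCycle {n} α zero = Data.Empty.⊥
  where import Data.Empty
HasCycle {n} α (suc m) =
  Σ (Fin (suc m) → Fin n) λ a →
    Injective _≡_ _≡_ a ×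
    (∀ i → α (a i) ≡ a (suc (toℕ i) mod suc m))

-- l(G) = k : k is the maximum of the cycle lengths of elements of ⟨G⟩
LEquals : ∀ {n} → Graph n → ℕ → Set
LEquals G k =
  (Σ (Transf _) λ α → InSG G α × HasCycle α k) ×
  (∀ α → InSG G α → ∀ m → HasCycle α m → m ≤ k)

data Walk {n : ℕ} (G : Graph n) : Fin n → Fin n → Set where
  here : ∀ {u} → Walk G u u
  step : ∀ {u v w} → Arc G u v → Walk G v w → Walk G u w

Connected : ∀ {n} → Graph n → Set
Connected G = ∀ u v → Walk G u v

_≅_ : ∀ {n} → Graph n → (Fin n → Fin n → Bool) → Set
_≅_ {n} G H = Σ (Fin n ↔ Fin n) λ σ →
  ∀ u v → adj G u v ≡ H (Inverse.to σ u) (Inverse.to σ v)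

-- adjacency on 1-indexed labels
private
  _==_ : ℕ → ℕ → Bool
  x == y = ⌊ x ℕ.≟ y ⌋

  isPair : ℕ → ℕ → ℕ → ℕ → Bool
  isPair p q x y = ((x == p) ∧ (y == q)) ∨ ((x == q) ∧ (y == p))

  pathAdjℕ : ℕ → ℕ → Bool
  pathAdjℕ x y = (suc x == y) ∨ (suc y == x)

  label : ∀ {n} → Fin n → ℕ
  label i = suc (toℕ i)

-- Q_n: path 1-2-...-n plus the edge {n-2, n}
qAdj : (n : ℕ) → Fin n → Fin n → Bool
qAdj n u v = pathAdjℕ (label u) (label v) ∨ isPair (n ∸ 2) n (label u) (label v)

-- R_n: Q_n with the edge {n-1, n} removed
rAdj : (n : ℕ) → Fin n → Fin n → Bool
rAdj n u v = qAdj n u v ∧ not (isPair (n ∸ 1) n (label u) (label v))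

-- Backward.  Number the vertices of Q_n (or its subgraph R_n) along the path.
-- Among three points kept apart, every element of ⟨G⟩ keeps the point of least
-- number least, which rules out cycles of length ≥ 3; a short explicit word on
-- the last vertices has a 2-cycle.
--
-- Forward.  l(G) = 2 forbids 3-cycles, and we exhibit 3-cycles for some
-- configurations: cycles of length ≥ 4, two branch vertices joined by a path,
-- and two small trees (each with an explicit word).  Along a longest path
-- P these leave two shapes: P covers G with one chord at an end (G ≅ Q_n; with
-- no chord G is a path, which has no 2-cycle), or one leaf hangs on the second
-- vertex of P from an end (G ≅ R_n).
module Submission where

open import Defs
open import Data.Nat using (ℕ; _≤_)
open import Data.Product using (_×_)
open import Data.Sum using (_⊎_)
open import Function.Bundles using (_⇔_)

open import Data.Nat as ℕ using (zero; suc; _<_; _+_; _∸_; z≤n; s≤s)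
open import Data.Nat.Properties
open import Data.Nat.DivMod using (_mod_; _%_; m<n⇒m%n≡m; n%n≡0)
open import Data.Fin as F using (Fin; toℕ; fromℕ; fromℕ<) renaming (zero to fz; suc to fs)
import Data.Fin.Properties as FP
open FP using (toℕ-injective; toℕ-fromℕ<; toℕ-fromℕ; toℕ<n; pigeonhole)
open import Data.Bool using (Bool; true; _∨_; _∧_; not)
import Data.Bool.Properties as BP
open BP using (⇔→≡)
open import Data.Product using (Σ; _,_; proj₁; proj₂)
import Data.Product.Properties as ×P
open import Data.Sum using (inj₁; inj₂)
open import Data.Unit using (⊤; tt)
open import Data.Empty using (⊥; ⊥-elim)
open import Data.List using (List; []; _∷_)
open import Data.List.Relation.Unary.All as All using (All; all?; []; _∷_)
open import Data.List.Membership.Propositional using (_∈_)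
import Data.List.Membership.DecPropositional as DecMembership
open import Function using (_∘_; id)
open import Function.Definitions using (Injective)
open import Function.Bundles using (_↔_; Inverse; Equivalence; mk↔ₛ′; mk⇔)
open import Relation.Nullary using (¬_; Dec; yes; no; does; proof; Reflects; invert)
open import Relation.Nullary.Decidable
  using (True; isYes≗does; dec-true; toWitness; _×-dec_; _⊎-dec_; _→-dec_; ¬?; decidable-stable)
open import Relation.Binary using (Tri; tri<; tri≈; tri>)
open import Relation.Binary.PropositionalEquality renaming (sym to ≡sym)

pattern #0 = fz
pattern #1 = fs #0
pattern #2 = fs #1
pattern #3 = fs #2
pattern #4 = fs #3
pattern #5 = fs #4

module _ {n : ℕ} where
  ↦-hit : (a b : Fin n) → [ a ↦ b ] a ≡ b
  ↦-hit a b with a F.≟ a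
  ... | yes _ = refl
  ... | no a≢a = ⊥-elim (a≢a refl)

  ↦-miss : (a b x : Fin n) → x ≢ a → [ a ↦ b ] x ≡ x
  ↦-miss a b x x≢a with x F.≟ a
  ... | yes x≡a = ⊥-elim (x≢a x≡a)
  ... | no _ = refl

  ↦-cases : (a b x : Fin n) → ([ a ↦ b ] x ≡ b × x ≡ a) ⊎ ([ a ↦ b ] x ≡ x × x ≢ a)
  ↦-cases a b x with x F.≟ a
  ... | yes refl = inj₁ (refl , refl)
  ... | no x≢a = inj₂ (refl , x≢a)

threeCycle : ∀ {n} {α : Transf n} (x y z : Fin n) → x ≢ y → y ≢ z → x ≢ z →
             α x ≡ y → α y ≡ z → α z ≡ x → HasCycle α 3
threeCycle {n} {α} x y z x≢y y≢z x≢z αx αy αz = point , point-inj , next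
  where
  point : Fin 3 → Fin n
  point #0 = x
  point #1 = y
  point #2 = z
  point-inj : Injective _≡_ _≡_ point
  point-inj {#0} {#0} _ = refl
  point-inj {#0} {#1} p = ⊥-elim (x≢y p)
  point-inj {#0} {#2} p = ⊥-elim (x≢z p)
  point-inj {#1} {#0} p = ⊥-elim (x≢y (≡sym p))
  point-inj {#1} {#1} _ = refl
  point-inj {#1} {#2} p = ⊥-elim (y≢z p)
  point-inj {#2} {#0} p = ⊥-elim (x≢z (≡sym p))
  point-inj {#2} {#1} p = ⊥-elim (y≢z (≡sym p))
  point-inj {#2} {#2} _ = refl
  next : ∀ i → α (point i) ≡ point (suc (toℕ i) mod 3)
  next #0 = αx
  next #1 = αy
  next #2 = αz

twoCycle : ∀ {n} {α : Transf n} (x y : Fin n) → x ≢ y → α x ≡ y → α y ≡ x → HasCycle α 2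
twoCycle {n} {α} x y x≢y αx αy = point , point-inj , next
  where
  point : Fin 2 → Fin n
  point #0 = x
  point #1 = y
  point-inj : Injective _≡_ _≡_ point
  point-inj {#0} {#0} _ = refl
  point-inj {#0} {#1} p = ⊥-elim (x≢y p)
  point-inj {#1} {#0} p = ⊥-elim (x≢y (≡sym p))
  point-inj {#1} {#1} _ = refl
  next : ∀ i → α (point i) ≡ point (suc (toℕ i) mod 2)
  next #0 = αx
  next #1 = αy

transportCycle : ∀ {k n} {α : Transf k} {β : Transf n} (e : Fin k → Fin n) →
  Injective _≡_ _≡_ e → (∀ x → β (e x) ≡ e (α x)) → ∀ ℓ → HasCycle α ℓ → HasCycle β ℓ
transportCycle e e-inj comm zero ()
transportCycle e e-inj comm (suc ℓ) (point , point-inj , next) =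
  e ∘ point , point-inj ∘ e-inj , λ i → trans (comm (point i)) (cong e (next i))

Word : ℕ → Set
Word k = List (Fin k × Fin k)

evalW : ∀ {k} → Word k → Transf k
evalW [] = id
evalW ((a , b) ∷ w) = [ a ↦ b ] ⨟ evalW w

mapW : ∀ {k n} → (Fin k → Fin n) → Word k → Word n
mapW e [] = []
mapW e ((a , b) ∷ w) = (e a , e b) ∷ mapW e w

evalW-mapW : ∀ {k n} (e : Fin k → Fin n) → Injective _≡_ _≡_ e →
             ∀ w x → evalW (mapW e w) (e x) ≡ e (evalW w x)
evalW-mapW e e-inj [] x = refl
evalW-mapW e e-inj ((a , b) ∷ w) x =
  trans (cong (evalW (mapW e w)) (renamed-move a b x)) (evalW-mapW e e-inj w ([ a ↦ b ] x))
  where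
  renamed-move : ∀ a b x → [ e a ↦ e b ] (e x) ≡ e ([ a ↦ b ] x)
  renamed-move a b x with ↦-cases a b x
  ... | inj₁ (hit , refl) = trans (↦-hit (e a) (e b)) (cong e (≡sym hit))
  ... | inj₂ (miss , x≢a) = trans (↦-miss (e a) (e b) (e x) (x≢a ∘ e-inj)) (cong e (≡sym miss))

Letter : ∀ {k} → List (Fin k × Fin k) → Fin k × Fin k → Set
Letter Es (a , b) = (a , b) ∈ Es ⊎ (b , a) ∈ Es

letter? : ∀ {k} (Es : List (Fin k × Fin k)) ℓ → Dec (Letter Es ℓ)
letter? Es (a , b) = ((a , b) ∈? Es) ⊎-dec ((b , a) ∈? Es)
  where open DecMembership (×P.≡-dec F._≟_ F._≟_) using (_∈?_)

record Pattern (k ℓ : ℕ) : Set where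
  field
    edges : List (Fin k × Fin k)
    word : Word k
    nonempty : word ≢ []
    letters : True (all? (letter? edges) word)
    cycle : HasCycle (evalW word) ℓ

module Moves {n : ℕ} (G : Graph n) where
  arc-sym : ∀ {a b} → Arc G a b → Arc G b a
  arc-sym {a} {b} e = trans (Graph.sym G b a) e

  arc-≢ : ∀ {a b} → Arc G a b → a ≢ b
  arc-≢ {a} e refl with trans (≡sym (loopless G a)) e
  ... | ()

  arc? : ∀ a b → Dec (Arc G a b)
  arc? a b = adj G a b BP.≟ true

  CycleIn : ℕ → Set
  CycleIn ℓ = Σ (Transf n) λ α → InSG G α × HasCycle α ℓ

  ThreeCycleIn : Set
  ThreeCycleIn = CycleIn 3

  module Invariant (P : Transf n → Set) (P-id : P id)
      (P-move : ∀ {α a b} → P α → Arc G a b → P (α ⨟ [ a ↦ b ])) where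
    invariant-⨟ : ∀ {α β} → P α → InSG G β → P (α ⨟ β)
    invariant-⨟ Pα (gen e) = P-move Pα e
    invariant-⨟ Pα (comp β₁ β₂) = invariant-⨟ (invariant-⨟ Pα β₁) β₂

    invariant : ∀ {α} → InSG G α → P α
    invariant = invariant-⨟ P-id

  slide : ∀ {a b} → Walk G a b → Transf n
  slide here = id
  slide (step {a} {b} _ w) = [ a ↦ b ] ⨟ slide w

  slide∈⟨G⟩ : ∀ {a b c} (e : Arc G a b) (w : Walk G b c) → InSG G (slide (step e w))
  slide∈⟨G⟩ e here = gen e
  slide∈⟨G⟩ e (step e' w) = comp (gen e) (slide∈⟨G⟩ e' w)

  slide-end : ∀ {a b} (w : Walk G a b) → slide w a ≡ b
  slide-end here = refl
  slide-end (step {a} {b} e w) = trans (cong (slide w) (↦-hit a b)) (slide-end w)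

  -- x is none of the vertices of the walk except possibly its last one.
  Avoids : ∀ {a b} → Fin n → Walk G a b → Set
  Avoids x here = ⊤
  Avoids x (step {a} _ w) = x ≢ a × Avoids x w

  slide-avoid : ∀ {a b} (w : Walk G a b) {x} → Avoids x w → slide w x ≡ x
  slide-avoid here _ = refl
  slide-avoid (step {a} {b} e w) {x} (x≢a , av) = trans (cong (slide w) (↦-miss a b x x≢a)) (slide-avoid w av)

  _++ʷ_ : ∀ {a b c} → Walk G a b → Walk G b c → Walk G a c
  here ++ʷ w' = w'
  step e w ++ʷ w' = step e (w ++ʷ w')

  avoids-++ : ∀ {a b c} (w : Walk G a b) (w' : Walk G b c) {x} → Avoids x w → Avoids x w' → Avoids x (w ++ʷ w')
  avoids-++ here w' _ av' = av'
  avoids-++ (step e w) w' (x≢a , av) av' = x≢a , avoids-++ w w' av av'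

  -- A cycle c₀ – h ⇝ c₂ – c₁ – c₀ of length ≥ 4 (r a walk from h to c₂ avoiding
  -- c₀, c₁) gives a 3-cycle: (c₀ → h)(c₁ → c₀)(c₂ → c₁)·slide r maps
  -- c₀ ↦ c₂ ↦ c₁ ↦ c₀.
  longCycle : ∀ c₀ c₁ c₂ h → Arc G c₀ h → Arc G c₁ c₀ → Arc G c₂ c₁ → (r : Walk G h c₂) →
    c₀ ≢ c₁ → c₁ ≢ c₂ → c₀ ≢ c₂ → h ≢ c₁ → h ≢ c₂ → Avoids c₀ r → Avoids c₁ r → ThreeCycleIn
  longCycle c₀ c₁ c₂ h e₁ e₂ e₃ here _ _ _ _ h≢c₂ _ _ = ⊥-elim (h≢c₂ refl)
  longCycle c₀ c₁ c₂ h e₁ e₂ e₃ r@(step e r') c₀≢c₁ c₁≢c₂ c₀≢c₂ h≢c₁ h≢c₂ av₀ av₁ =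
    α , comp (gen e₁) (comp (gen e₂) (comp (gen e₃) (slide∈⟨G⟩ e r'))) ,
    threeCycle {α = α} c₀ c₂ c₁ c₀≢c₂ (c₁≢c₂ ∘ ≡sym) c₀≢c₁ α₀ α₂ α₁
    where
    α : Transf n
    α = [ c₀ ↦ h ] ⨟ ([ c₁ ↦ c₀ ] ⨟ ([ c₂ ↦ c₁ ] ⨟ slide r))
    open ≡-Reasoning
    α₀ : α c₀ ≡ c₂
    α₀ = begin
      slide r ([ c₂ ↦ c₁ ] ([ c₁ ↦ c₀ ] ([ c₀ ↦ h ] c₀)))
        ≡⟨ cong (λ z → slide r ([ c₂ ↦ c₁ ] ([ c₁ ↦ c₀ ] z))) (↦-hit c₀ h) ⟩
      slide r ([ c₂ ↦ c₁ ] ([ c₁ ↦ c₀ ] h))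
        ≡⟨ cong (λ z → slide r ([ c₂ ↦ c₁ ] z)) (↦-miss c₁ c₀ h h≢c₁) ⟩
      slide r ([ c₂ ↦ c₁ ] h)
        ≡⟨ cong (slide r) (↦-miss c₂ c₁ h h≢c₂) ⟩
      slide r h
        ≡⟨ slide-end r ⟩
      c₂ ∎
    α₁ : α c₁ ≡ c₀
    α₁ = begin
      slide r ([ c₂ ↦ c₁ ] ([ c₁ ↦ c₀ ] ([ c₀ ↦ h ] c₁)))
        ≡⟨ cong (λ z → slide r ([ c₂ ↦ c₁ ] ([ c₁ ↦ c₀ ] z))) (↦-miss c₀ h c₁ (c₀≢c₁ ∘ ≡sym)) ⟩
      slide r ([ c₂ ↦ c₁ ] ([ c₁ ↦ c₀ ] c₁))
        ≡⟨ cong (λ z → slide r ([ c₂ ↦ c₁ ] z)) (↦-hit c₁ c₀) ⟩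
      slide r ([ c₂ ↦ c₁ ] c₀)
        ≡⟨ cong (slide r) (↦-miss c₂ c₁ c₀ c₀≢c₂) ⟩
      slide r c₀
        ≡⟨ slide-avoid r av₀ ⟩
      c₀ ∎
    α₂ : α c₂ ≡ c₁
    α₂ = begin
      slide r ([ c₂ ↦ c₁ ] ([ c₁ ↦ c₀ ] ([ c₀ ↦ h ] c₂)))
        ≡⟨ cong (λ z → slide r ([ c₂ ↦ c₁ ] ([ c₁ ↦ c₀ ] z))) (↦-miss c₀ h c₂ (c₀≢c₂ ∘ ≡sym)) ⟩
      slide r ([ c₂ ↦ c₁ ] ([ c₁ ↦ c₀ ] c₂))
        ≡⟨ cong (λ z → slide r ([ c₂ ↦ c₁ ] z)) (↦-miss c₁ c₀ c₂ (c₁≢c₂ ∘ ≡sym)) ⟩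
      slide r ([ c₂ ↦ c₁ ] c₂)
        ≡⟨ cong (slide r) (↦-hit c₂ c₁) ⟩
      slide r c₁
        ≡⟨ slide-avoid r av₁ ⟩
      c₁ ∎

  -- Two branch vertices: u with further neighbours x, y and v with further
  -- neighbours s, t, joined by walks r₁ : u ⇝ v and r₂ : v ⇝ u (u = v is allowed,
  -- giving a vertex of degree ≥ 4).  Sliding along y ⇝ t, x ⇝ y, s ⇝ x, t ⇝ s in turn
  -- produces the 3-cycle x ↦ y ↦ s ↦ x.
  twoBranches : ∀ {u v} (r₁ : Walk G u v) (r₂ : Walk G v u) (x y s t : Fin n) →
    Arc G x u → Arc G y u → Arc G s v → Arc G t v →
    x ≢ y → x ≢ s → x ≢ t → y ≢ s → y ≢ t → s ≢ t →
    x ≢ u → y ≢ u → s ≢ u → t ≢ u → x ≢ v → y ≢ v → s ≢ v → t ≢ v →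
    Avoids x r₁ → Avoids s r₁ → Avoids y r₂ → Avoids t r₂ → ThreeCycleIn
  twoBranches {u} {v} r₁ r₂ x y s t xu yu sv tv x≢y x≢s x≢t y≢s y≢t s≢t
              x≢u y≢u s≢u t≢u x≢v y≢v s≢v t≢v x∉r₁ s∉r₁ y∉r₂ t∉r₂ =
    α , comp (slide∈⟨G⟩ yu w₁') (comp (slide∈⟨G⟩ xu w₂') (comp (slide∈⟨G⟩ sv w₃') (slide∈⟨G⟩ tv w₄'))) ,
    threeCycle {α = α} x y s x≢y y≢s x≢s αx αy αs
    where
    w₁' : Walk G u t
    w₁' = r₁ ++ʷ step (arc-sym tv) here
    w₂' : Walk G u y
    w₂' = step (arc-sym yu) here
    w₃' : Walk G v x
    w₃' = r₂ ++ʷ step (arc-sym xu) here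
    w₄' : Walk G v s
    w₄' = step (arc-sym sv) here
    w₁ : Walk G y t
    w₁ = step yu w₁'
    w₂ : Walk G x y
    w₂ = step xu w₂'
    w₃ : Walk G s x
    w₃ = step sv w₃'
    w₄ : Walk G t s
    w₄ = step tv w₄'
    α : Transf n
    α = slide w₁ ⨟ (slide w₂ ⨟ (slide w₃ ⨟ slide w₄))
    avoids₁ : ∀ {z} → z ≢ y → Avoids z r₁ → z ≢ v → Avoids z w₁
    avoids₁ z≢y z∉r₁ z≢v = z≢y , avoids-++ r₁ _ z∉r₁ (z≢v , tt)
    avoids₃ : ∀ {z} → z ≢ s → Avoids z r₂ → z ≢ u → Avoids z w₃
    avoids₃ z≢s z∉r₂ z≢u = z≢s , avoids-++ r₂ _ z∉r₂ (z≢u , tt)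
    open ≡-Reasoning
    αx : α x ≡ y
    αx = begin
      slide w₄ (slide w₃ (slide w₂ (slide w₁ x)))
        ≡⟨ cong (λ z → slide w₄ (slide w₃ (slide w₂ z))) (slide-avoid w₁ (avoids₁ x≢y x∉r₁ x≢v)) ⟩
      slide w₄ (slide w₃ (slide w₂ x))
        ≡⟨ cong (λ z → slide w₄ (slide w₃ z)) (slide-end w₂) ⟩
      slide w₄ (slide w₃ y)
        ≡⟨ cong (slide w₄) (slide-avoid w₃ (avoids₃ y≢s y∉r₂ y≢u)) ⟩
      slide w₄ y
        ≡⟨ slide-avoid w₄ (y≢t , y≢v , tt) ⟩
      y ∎
    αy : α y ≡ s
    αy = begin
      slide w₄ (slide w₃ (slide w₂ (slide w₁ y)))
        ≡⟨ cong (λ z → slide w₄ (slide w₃ (slide w₂ z))) (slide-end w₁) ⟩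
      slide w₄ (slide w₃ (slide w₂ t))
        ≡⟨ cong (λ z → slide w₄ (slide w₃ z)) (slide-avoid w₂ ((x≢t ∘ ≡sym) , t≢u , tt)) ⟩
      slide w₄ (slide w₃ t)
        ≡⟨ cong (slide w₄) (slide-avoid w₃ (avoids₃ (s≢t ∘ ≡sym) t∉r₂ t≢u)) ⟩
      slide w₄ t
        ≡⟨ slide-end w₄ ⟩
      s ∎
    αs : α s ≡ x
    αs = begin
      slide w₄ (slide w₃ (slide w₂ (slide w₁ s)))
        ≡⟨ cong (λ z → slide w₄ (slide w₃ (slide w₂ z))) (slide-avoid w₁ (avoids₁ (y≢s ∘ ≡sym) s∉r₁ s≢v)) ⟩
      slide w₄ (slide w₃ (slide w₂ s))
        ≡⟨ cong (λ z → slide w₄ (slide w₃ z)) (slide-avoid w₂ ((x≢s ∘ ≡sym) , s≢u , tt)) ⟩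
      slide w₄ (slide w₃ s)
        ≡⟨ cong (slide w₄) (slide-end w₃) ⟩
      slide w₄ x
        ≡⟨ slide-avoid w₄ (x≢t , x≢v , tt) ⟩
      x ∎

  ArcLetter : Fin n × Fin n → Set
  ArcLetter (a , b) = Arc G a b

  word∈⟨G⟩ : ∀ w → w ≢ [] → All ArcLetter w → InSG G (evalW w)
  word∈⟨G⟩ [] w≢[] _ = ⊥-elim (w≢[] refl)
  word∈⟨G⟩ (_ ∷ []) _ (arc ∷ []) = gen arc
  word∈⟨G⟩ (_ ∷ w@(_ ∷ _)) _ (arc ∷ arcs) = comp (gen arc) (word∈⟨G⟩ w (λ ()) arcs)

  EdgesTo : ∀ {k} → (Fin k → Fin n) → List (Fin k × Fin k) → Set
  EdgesTo e Es = All (λ p → Arc G (e (proj₁ p)) (e (proj₂ p))) Es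

  patternCycle : ∀ {k ℓ} (P : Pattern k ℓ) (e : Fin k → Fin n) → Injective _≡_ _≡_ e →
                 EdgesTo e (Pattern.edges P) → CycleIn ℓ
  patternCycle {ℓ = ℓ} P e e-inj arcs =
    evalW (mapW e word) ,
    word∈⟨G⟩ (mapW e word) (mapW-nonempty word nonempty) (arcsOf word (toWitness letters)) ,
    transportCycle {β = evalW (mapW e word)} e e-inj (evalW-mapW e e-inj word) ℓ cycle
    where
    open Pattern P
    letterArc : ∀ {a b} → Letter edges (a , b) → Arc G (e a) (e b)
    letterArc (inj₁ mem) = All.lookup arcs mem
    letterArc (inj₂ mem) = arc-sym (All.lookup arcs mem)
    arcsOf : ∀ u → All (Letter edges) u → All ArcLetter (mapW e u)
    arcsOf [] [] = []
    arcsOf ((a , b) ∷ u) (l ∷ ls) = letterArc l ∷ arcsOf u ls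
    mapW-nonempty : ∀ u → u ≢ [] → mapW e u ≢ []
    mapW-nonempty [] u≢[] = ⊥-elim (u≢[] refl)
    mapW-nonempty (_ ∷ _) _ ()

-- The patterns used below; the cycles of their words are checked by computation.
-- The triangle 0 – 1 – 2 – 0 (the end of Q_n) has a 2-cycle.
triangleWord : Word 3
triangleWord = (#0 , #2) ∷ (#1 , #0) ∷ (#2 , #1) ∷ []

triangle : Pattern 3 2
triangle = record
  { edges = (#0 , #1) ∷ (#1 , #2) ∷ (#0 , #2) ∷ []
  ; word = triangleWord
  ; nonempty = λ ()
  ; letters = tt
  ; cycle = twoCycle {α = evalW triangleWord} #0 #1 (λ ()) refl refl
  }

-- The star with centre 1 and leaves 0, 2, 3 (the end of R_n) has a 2-cycle.
starWord : Word 4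
starWord = (#0 , #1) ∷ (#1 , #3) ∷ (#2 , #1) ∷ (#1 , #0) ∷ (#3 , #1) ∷ (#1 , #2) ∷ []

star : Pattern 4 2
star = record
  { edges = (#0 , #1) ∷ (#1 , #2) ∷ (#1 , #3) ∷ []
  ; word = starWord
  ; nonempty = λ ()
  ; letters = tt
  ; cycle = twoCycle {α = evalW starWord} #0 #2 (λ ()) refl refl
  }

bullWord : Word 5
bullWord = (#0 , #1) ∷ (#1 , #2) ∷ (#3 , #1) ∷ (#1 , #0) ∷ (#4 , #3) ∷
           (#3 , #1) ∷ (#2 , #3) ∷ (#3 , #4) ∷ (#1 , #3) ∷ []

bull : Pattern 5 3
bull = record
  { edges = (#0 , #1) ∷ (#1 , #2) ∷ (#2 , #3) ∷ (#3 , #4) ∷ (#1 , #3) ∷ []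
  ; word = bullWord
  ; nonempty = λ ()
  ; letters = tt
  ; cycle = threeCycle {α = evalW bullWord} #0 #4 #3 (λ ()) (λ ()) (λ ()) refl refl refl
  }

spiderWord : Word 6
spiderWord = (#1 , #2) ∷ (#2 , #3) ∷ (#3 , #4) ∷ (#0 , #3) ∷ (#3 , #2) ∷
             (#2 , #1) ∷ (#4 , #3) ∷ (#3 , #2) ∷ (#5 , #4) ∷ (#4 , #3) ∷
             (#3 , #0) ∷ (#2 , #3) ∷ (#3 , #4) ∷ (#4 , #5) ∷ []

spider : Pattern 6 3
spider = record
  { edges = (#1 , #2) ∷ (#2 , #3) ∷ (#3 , #4) ∷ (#4 , #5) ∷ (#0 , #3) ∷ []
  ; word = spiderWord
  ; nonempty = λ ()
  ; letters = tt
  ; cycle = threeCycle {α = evalW spiderWord} #1 #5 #0 (λ ()) (λ ()) (λ ()) refl refl refl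
  }

module CyclicSuccessor (m : ℕ) where
  next : Fin (suc m) → Fin (suc m)
  next i = suc (toℕ i) mod (suc m)

  next-cases : ∀ i → (toℕ i < m × toℕ (next i) ≡ suc (toℕ i)) ⊎ (toℕ i ≡ m × toℕ (next i) ≡ 0)
  next-cases i with m≤n⇒m<n∨m≡n (m<1+n⇒m≤n (toℕ<n i))
  ... | inj₁ i<m = inj₁ (i<m , trans (toℕ-fromℕ< _) (m<n⇒m%n≡m (s≤s i<m)))
  ... | inj₂ i≡m = inj₂ (i≡m , next-last i i≡m)
    where
    next-last : ∀ i → toℕ i ≡ m → toℕ (next i) ≡ 0
    next-last i i≡m = trans (toℕ-fromℕ< _) (subst (λ z → suc z % suc m ≡ 0) (≡sym i≡m) (n%n≡0 (suc m)))

  next≢ : 1 ≤ m → ∀ i → next i ≢ i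
  next≢ 1≤m i eq with next-cases i
  ... | inj₁ (_ , v) = 1+n≢n (trans (≡sym v) (cong toℕ eq))
  ... | inj₂ (e , v) = <⇒≢ 1≤m (trans (trans (≡sym v) (cong toℕ eq)) e)

  next²≢ : 2 ≤ m → ∀ i → next (next i) ≢ i
  next²≢ 2≤m i eq with next-cases i | next-cases (next i)
  ... | inj₁ (_ , v) | inj₁ (_ , v₂) = 2+n≢n (trans (trans (cong suc (≡sym v)) (≡sym v₂)) (cong toℕ eq))
    where
    2+n≢n : ∀ {t} → suc (suc t) ≢ t
    2+n≢n ()
  ... | inj₁ (_ , v) | inj₂ (e₂ , v₂) =
        <⇒≢ 2≤m (≡sym (trans (≡sym e₂) (trans v (cong suc (trans (≡sym (cong toℕ eq)) v₂)))))
  ... | inj₂ (e , v) | inj₁ (_ , v₂) =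
        <⇒≢ 2≤m (trans (≡sym (trans v₂ (cong suc v))) (trans (cong toℕ eq) e))
  ... | inj₂ (e , v) | inj₂ (e₂ , v₂) =
        <⇒≢ (≤-trans (s≤s z≤n) 2≤m) (trans (≡sym v) e₂)

  prev : ∀ i → Σ (Fin (suc m)) λ p → next p ≡ i
  prev fz with next-cases (fromℕ m)
  ... | inj₁ (m<m , _) = ⊥-elim (<-irrefl (toℕ-fromℕ m) m<m)
  ... | inj₂ (_ , v) = fromℕ m , toℕ-injective v
  prev (fs j) with next-cases (F.inject₁ j)
  ... | inj₁ (_ , v) = F.inject₁ j , toℕ-injective (trans v (cong suc (FP.toℕ-inject₁ j)))
  ... | inj₂ (e , _) = ⊥-elim (<⇒≢ (subst (_< m) (≡sym (FP.toℕ-inject₁ j)) (toℕ<n j)) e)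

argmin : ∀ {k} (f : Fin (suc k) → ℕ) → Σ (Fin (suc k)) λ i → ∀ j → f i ≤ f j
argmin {zero} f = fz , λ { fz → ≤-refl }
argmin {suc k} f with argmin (λ j → f (fs j))
... | (i , h) with f fz ≤? f (fs i)
...   | yes le = fz , λ { fz → ≤-refl ; (fs j) → ≤-trans le (h j) }
...   | no nle = fs i , λ { fz → <⇒≤ (≰⇒> nle) ; (fs j) → h j }

module Labelling {n : ℕ} (L : Fin n → ℕ) (L-inj : ∀ {x y} → L x ≡ L y → x ≡ y) where

  L≢ : ∀ {x y} → x ≢ y → L x ≢ L y
  L≢ x≢y e = x≢y (L-inj e)

  -- If every edge changes the label by one (G is a path numbered along itself),
  -- every element of ⟨G⟩ preserves the order of any two points it keeps apart;
  -- hence no element has a 2-cycle.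
  module PathLike (G : Graph n)
      (edge : ∀ {p q} → Arc G p q → L q ≡ suc (L p) ⊎ L p ≡ suc (L q)) where

    OrderPreserving : Transf n → Set
    OrderPreserving α = ∀ x y → L x < L y → α x ≢ α y → L (α x) < L (α y)

    preserved-by-move : ∀ {α p q} → OrderPreserving α → Arc G p q → OrderPreserving (α ⨟ [ p ↦ q ])
    preserved-by-move {α} {p} {q} P pq x y lt ne with ↦-cases p q (α x) | ↦-cases p q (α y)
    ... | inj₁ (gx , refl) | inj₁ (gy , _) = ⊥-elim (ne (trans gx (≡sym gy)))
    ... | inj₁ (gx , refl) | inj₂ (gy , αy≢p) = subst₂ (λ u v → L u < L v) (≡sym gx) (≡sym gy) moved
      where
      -- the smaller point p moves to its neighbour q, which stays below α y
      moved : L q < L (α y)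
      moved with edge pq
      ... | inj₁ up = ≤∧≢⇒< (subst (_≤ L (α y)) (≡sym up) (P x y lt (αy≢p ∘ ≡sym)))
                            (L≢ λ q≡αy → ne (trans gx (trans q≡αy (≡sym gy))))
      ... | inj₂ down = <-trans (subst (L q <_) (≡sym down) ≤-refl) (P x y lt (αy≢p ∘ ≡sym))
    ... | inj₂ (gx , αx≢p) | inj₁ (gy , refl) = subst₂ (λ u v → L u < L v) (≡sym gx) (≡sym gy) moved
      where
      -- the larger point p moves to its neighbour q, which stays above α x
      moved : L (α x) < L q
      moved with edge pq
      ... | inj₁ up = <-trans (P x y lt αx≢p) (subst (L p <_) (≡sym up) ≤-refl)
      ... | inj₂ down = ≤∧≢⇒< (m<1+n⇒m≤n (subst (L (α x) <_) down (P x y lt αx≢p)))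
                              (L≢ λ αx≡q → ne (trans gx (trans αx≡q (≡sym gy))))
    ... | inj₂ (gx , _) | inj₂ (gy , _) =
      subst₂ (λ u v → L u < L v) (≡sym gx) (≡sym gy) (P x y lt (λ e → ne (trans gx (trans e (≡sym gy)))))

    orderPreserving : ∀ {α} → InSG G α → OrderPreserving α
    orderPreserving = Moves.Invariant.invariant G OrderPreserving (λ x y x<y _ → x<y) preserved-by-move

    noTwoCycle : ∀ {α} → InSG G α → ¬ HasCycle α 2
    noTwoCycle {α} α∈ (a , a-inj , cyc) = compare (<-cmp (L (a #0)) (L (a #1)))
      where
      #0≢#1 : #0 ≢ #1
      #0≢#1 ()
      images≢ : α (a #0) ≢ α (a #1)
      images≢ e = #0≢#1 (a-inj (trans (≡sym (cyc #1)) (trans (≡sym e) (cyc #0))))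
      -- The order of the two points would have to be both kept and swapped.
      compare : Tri (L (a #0) < L (a #1)) (L (a #0) ≡ L (a #1)) (L (a #1) < L (a #0)) → ⊥
      compare (tri< lt _ _) = <-asym lt (subst₂ (λ u v → L u < L v) (cyc #0) (cyc #1)
                                (orderPreserving α∈ (a #0) (a #1) lt images≢))
      compare (tri≈ _ eq _) = #0≢#1 (a-inj (L-inj eq))
      compare (tri> _ _ gt) = <-asym gt (subst₂ (λ u v → L u < L v) (cyc #1) (cyc #0)
                                (orderPreserving α∈ (a #1) (a #0) gt (images≢ ∘ ≡sym)))

  -- On a cycle of length ≥ 3 take the point u of least label, its predecessor
  -- w and its successor v: the points w, u, v and their images u, v, α v are
  -- pairwise distinct.
  record LeastOnCycle (α : Transf n) : Set where
    field
      w u v : Fin n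
      αw : α w ≡ u
      αu : α u ≡ v
      u<w : L u < L w
      u<v : L u < L v
      w≢v : w ≢ v
      u≢αv : u ≢ α v
      v≢αv : v ≢ α v

  leastOnCycle : ∀ {α} m → HasCycle α (3 + m) → LeastOnCycle α
  leastOnCycle {α} m (point , point-inj , cyc) = record
    { w = point p ; u = point i₀ ; v = point (next i₀)
    ; αw = trans (cyc p) (cong point next-p)
    ; αu = cyc i₀
    ; u<w = ≤∧≢⇒< (least p) (L≢ (point≢ λ e → next≢ 1≤ p (trans next-p e)))
    ; u<v = ≤∧≢⇒< (least (next i₀)) (L≢ (point≢ λ e → next≢ 1≤ i₀ (≡sym e)))
    ; w≢v = point≢ λ e → next²≢ 2≤ p (≡sym (trans e (cong next (≡sym next-p))))
    ; u≢αv = λ e → point≢ (λ e' → next²≢ 2≤ i₀ (≡sym e')) (trans e (cyc (next i₀)))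
    ; v≢αv = λ e → point≢ (λ e' → next≢ 1≤ (next i₀) (≡sym e')) (trans e (cyc (next i₀)))
    }
    where
    open CyclicSuccessor (suc (suc m))
    i₀ : Fin (3 + m)
    i₀ = proj₁ (argmin (L ∘ point))
    least : ∀ j → L (point i₀) ≤ L (point j)
    least = proj₂ (argmin (L ∘ point))
    p : Fin (3 + m)
    p = proj₁ (prev i₀)
    next-p : next p ≡ i₀
    next-p = proj₂ (prev i₀)
    point≢ : ∀ {i j} → i ≢ j → point i ≢ point j
    point≢ i≢j e = i≢j (point-inj e)
    1≤ : 1 ≤ suc (suc m)
    1≤ = s≤s z≤n
    2≤ : 2 ≤ suc (suc m)
    2≤ = s≤s (s≤s z≤n)

  private
    between : ∀ {a y} → a < y → y ≤ suc (suc a) → y ≢ suc (suc a) → y ≡ suc a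
    between a<y y≤ y≢ = ≤-antisym (m<1+n⇒m≤n (≤∧≢⇒< y≤ y≢)) a<y

    below : ∀ {a x z} → x < z → z ≤ suc (suc a) → z ≢ suc (suc a) → x ≢ a → x < a
    below x<z z≤ z≢ x≢a with m≤n⇒m<n∨m≡n (m<1+n⇒m≤n (≤∧≢⇒< z≤ z≢))
    ... | inj₁ z<1+a = ≤∧≢⇒< (m<1+n⇒m≤n (<-trans x<z z<1+a)) x≢a
    ... | inj₂ refl = ≤∧≢⇒< (m<1+n⇒m≤n x<z) x≢a

  -- The labelling of Q_n: labels are ≤ a + 2 and every edge changes the label by
  -- one or joins the labels a and a + 2.  Then, among three points kept apart,
  -- every element of ⟨G⟩ keeps the point of least label least; so ⟨G⟩ has no
  -- cycle of length ≥ 3.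
  module QLike (G : Graph n) (a : ℕ) (L≤ : ∀ x → L x ≤ suc (suc a))
      (edge : ∀ {p q} → Arc G p q →
        L q ≡ suc (L p) ⊎ L p ≡ suc (L q) ⊎ (L p ≡ a × L q ≡ suc (suc a)) ⊎ (L p ≡ suc (suc a) × L q ≡ a)) where

    neighbour-of-least : ∀ {p q y z} → Arc G p q → L p < L y → L p < L z → y ≢ z → q ≢ y → q ≢ z → L q < L y
    neighbour-of-least {p} {q} {y} {z} pq p<y p<z y≢z q≢y q≢z with edge pq
    ... | inj₁ up = ≤∧≢⇒< (subst (_≤ L y) (≡sym up) p<y) (L≢ q≢y)
    ... | inj₂ (inj₁ down) = <-trans (subst (L q <_) (≡sym down) ≤-refl) p<y
    ... | inj₂ (inj₂ (inj₁ (p≡a , q≡a+2))) = ⊥-elim (y≢z (L-inj (trans (middle q≢y p<y) (≡sym (middle q≢z p<z)))))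
      where
      -- y and z would both carry the only label strictly between a and a + 2
      middle : ∀ {r} → q ≢ r → L p < L r → L r ≡ suc a
      middle q≢r p<r = between (subst (_< _) p≡a p<r) (L≤ _) (λ e → L≢ q≢r (trans q≡a+2 (≡sym e)))
    ... | inj₂ (inj₂ (inj₂ (p≡a+2 , _))) = ⊥-elim (<⇒≱ (subst (_< L y) p≡a+2 p<y) (L≤ y))

    neighbour-above-least : ∀ {p q x z} → Arc G p q → L x < L p → L x < L z → z ≢ p → x ≢ q → L x < L q
    neighbour-above-least {p} {q} {x} {z} pq x<p x<z z≢p x≢q with edge pq
    ... | inj₁ up = <-trans x<p (subst (L p <_) (≡sym up) ≤-refl)
    ... | inj₂ (inj₁ down) = ≤∧≢⇒< (m<1+n⇒m≤n (subst (L x <_) down x<p)) (L≢ x≢q)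
    ... | inj₂ (inj₂ (inj₁ (p≡a , q≡a+2))) =
          subst (L x <_) (≡sym q≡a+2) (<-trans (subst (L x <_) p≡a x<p) (m<n⇒m<1+n (n<1+n a)))
    ... | inj₂ (inj₂ (inj₂ (p≡a+2 , q≡a))) =
          subst (L x <_) (≡sym q≡a)
            (below x<z (L≤ z) (λ e → z≢p (L-inj (trans e (≡sym p≡a+2)))) (λ e → L≢ x≢q (trans e (≡sym q≡a))))

    LeastStays : Transf n → Set
    LeastStays α = ∀ x y z → L x < L y → L x < L z → y ≢ z →
                   α x ≢ α y → α x ≢ α z → α y ≢ α z → L (α x) < L (α y)

    stays-by-move : ∀ {α p q} → LeastStays α → Arc G p q → LeastStays (α ⨟ [ p ↦ q ])
    stays-by-move {α} {p} {q} I pq x y z x<y x<z y≢z gx≢gy gx≢gz gy≢gz =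
        go (↦-cases p q (α x)) (↦-cases p q (α y)) (↦-cases p q (α z))
      where
      g : Transf n
      g = [ p ↦ q ]
      αx<αy : L (α x) < L (α y)
      αx<αy = I x y z x<y x<z y≢z (gx≢gy ∘ cong g) (gx≢gz ∘ cong g) (gy≢gz ∘ cong g)
      αx<αz : L (α x) < L (α z)
      αx<αz = I x z y x<z x<y (y≢z ∘ ≡sym) (gx≢gz ∘ cong g) (gx≢gy ∘ cong g) (gy≢gz ∘ ≡sym ∘ cong g)
      Case : Fin n → Set
      Case r = (g r ≡ q × r ≡ p) ⊎ (g r ≡ r × r ≢ p)
      go : Case (α x) → Case (α y) → Case (α z) → L (g (α x)) < L (g (α y))
      go (inj₁ (_ , ex)) (inj₁ (_ , ey)) _ = ⊥-elim (gx≢gy (cong g (trans ex (≡sym ey))))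
      go (inj₁ (_ , ex)) _ (inj₁ (_ , ez)) = ⊥-elim (gx≢gz (cong g (trans ex (≡sym ez))))
      go _ (inj₁ (_ , ey)) (inj₁ (_ , ez)) = ⊥-elim (gy≢gz (cong g (trans ey (≡sym ez))))
      go (inj₁ (gx , refl)) (inj₂ (gy , _)) (inj₂ (gz , _)) =
        subst₂ (λ u v → L u < L v) (≡sym gx) (≡sym gy)
          (neighbour-of-least pq αx<αy αx<αz (λ e → gy≢gz (trans gy (trans e (≡sym gz))))
            (λ e → gx≢gy (trans gx (trans e (≡sym gy)))) (λ e → gx≢gz (trans gx (trans e (≡sym gz)))))
      go (inj₂ (gx , _)) (inj₁ (gy , refl)) (inj₂ (gz , αz≢p)) =
        subst₂ (λ u v → L u < L v) (≡sym gx) (≡sym gy)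
          (neighbour-above-least pq αx<αy αx<αz αz≢p (λ e → gx≢gy (trans gx (trans e (≡sym gy)))))
      go (inj₂ (gx , _)) (inj₂ (gy , _)) _ = subst₂ (λ u v → L u < L v) (≡sym gx) (≡sym gy) αx<αy

    leastStays : ∀ {α} → InSG G α → LeastStays α
    leastStays = Moves.Invariant.invariant G LeastStays (λ x y z x<y _ _ _ _ _ → x<y) stays-by-move

    cycles≤2 : ∀ {α} → InSG G α → ∀ k → HasCycle α k → k ≤ 2
    cycles≤2 α∈ 0 ()
    cycles≤2 α∈ 1 _ = s≤s z≤n
    cycles≤2 α∈ 2 _ = s≤s (s≤s z≤n)
    cycles≤2 {α} α∈ (suc (suc (suc m))) cyc = ⊥-elim (<-asym u<v (subst₂ (λ x y → L x < L y) αu αw v<u))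
      where
      open LeastOnCycle (leastOnCycle {α = α} m cyc)
      -- u is least among u, w, v, so α u = v would have to stay below α w = u
      v<u : L (α u) < L (α w)
      v<u = leastStays α∈ u w v u<w u<v w≢v
              (λ e → v≢u (trans (≡sym αu) (trans e αw)))
              (λ e → v≢αv (trans (≡sym αu) e))
              (λ e → u≢αv (trans (≡sym αw) e))
        where
        v≢u : v ≢ u
        v≢u e = <-irrefl (cong L (≡sym e)) u<v

-- The adjacency of Q_n and R_n, read on 0-based labels i, j < n.
QRel : ℕ → ℕ → ℕ → Set
QRel n i j = (suc i ≡ j ⊎ suc j ≡ i) ⊎ ((suc i ≡ n ∸ 2 × suc j ≡ n) ⊎ (suc i ≡ n × suc j ≡ n ∸ 2))

RPair : ℕ → ℕ → ℕ → Set
RPair n i j = (suc i ≡ n ∸ 1 × suc j ≡ n) ⊎ (suc i ≡ n × suc j ≡ n ∸ 1)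

RRel : ℕ → ℕ → ℕ → Set
RRel n i j = QRel n i j × ¬ RPair n i j

QRel-swap : ∀ {n i j} → QRel n i j → QRel n j i
QRel-swap (inj₁ (inj₁ e)) = inj₁ (inj₂ e)
QRel-swap (inj₁ (inj₂ e)) = inj₁ (inj₁ e)
QRel-swap (inj₂ (inj₁ (e₁ , e₂))) = inj₂ (inj₂ (e₂ , e₁))
QRel-swap (inj₂ (inj₂ (e₁ , e₂))) = inj₂ (inj₁ (e₂ , e₁))

RPair-swap : ∀ {n i j} → RPair n i j → RPair n j i
RPair-swap (inj₁ (e₁ , e₂)) = inj₂ (e₂ , e₁)
RPair-swap (inj₂ (e₁ , e₂)) = inj₁ (e₂ , e₁)

RRel-swap : ∀ {n i j} → RRel n i j → RRel n j i
RRel-swap (r , nr) = QRel-swap r , nr ∘ RPair-swap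

qRel? : ∀ n i j → Dec (QRel n i j)
qRel? n i j = ((suc i ℕ.≟ j) ⊎-dec (suc j ℕ.≟ i)) ⊎-dec
              (((suc i ℕ.≟ n ∸ 2) ×-dec (suc j ℕ.≟ n)) ⊎-dec ((suc i ℕ.≟ n) ×-dec (suc j ℕ.≟ n ∸ 2)))

rPair? : ∀ n i j → Dec (RPair n i j)
rPair? n i j = ((suc i ℕ.≟ n ∸ 1) ×-dec (suc j ℕ.≟ n)) ⊎-dec ((suc i ℕ.≟ n) ×-dec (suc j ℕ.≟ n ∸ 1))

qAdj≡ : ∀ n (u v : Fin n) → qAdj n u v ≡ does (qRel? n (toℕ u) (toℕ v))
qAdj≡ n u v =
  cong₂ _∨_ (cong₂ _∨_ (isYes≗does (suc i ℕ.≟ j)) (isYes≗does (suc j ℕ.≟ i)))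
            (cong₂ _∨_ (cong₂ _∧_ (isYes≗does (i ℕ.≟ n ∸ 2)) (isYes≗does (j ℕ.≟ n)))
                       (cong₂ _∧_ (isYes≗does (i ℕ.≟ n)) (isYes≗does (j ℕ.≟ n ∸ 2))))
  where
  i j : ℕ
  i = suc (toℕ u)
  j = suc (toℕ v)

rAdj≡ : ∀ n (u v : Fin n) → rAdj n u v ≡ does (qRel? n (toℕ u) (toℕ v) ×-dec ¬? (rPair? n (toℕ u) (toℕ v)))
rAdj≡ n u v = cong₂ _∧_ (qAdj≡ n u v)
  (cong not (cong₂ _∨_ (cong₂ _∧_ (isYes≗does (i ℕ.≟ n ∸ 1)) (isYes≗does (j ℕ.≟ n)))
                       (cong₂ _∧_ (isYes≗does (i ℕ.≟ n)) (isYes≗does (j ℕ.≟ n ∸ 1)))))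
  where
  i j : ℕ
  i = suc (toℕ u)
  j = suc (toℕ v)

does⇔ : ∀ {A : Set} (d : Dec A) → does d ≡ true ⇔ A
does⇔ d = mk⇔ (λ eq → invert (subst (Reflects _) eq (proof d))) (dec-true d)

qAdj⇔ : ∀ n (u v : Fin n) → qAdj n u v ≡ true ⇔ QRel n (toℕ u) (toℕ v)
qAdj⇔ n u v = subst (λ b → b ≡ true ⇔ QRel n (toℕ u) (toℕ v)) (≡sym (qAdj≡ n u v))
                (does⇔ (qRel? n (toℕ u) (toℕ v)))

rAdj⇔ : ∀ n (u v : Fin n) → rAdj n u v ≡ true ⇔ RRel n (toℕ u) (toℕ v)
rAdj⇔ n u v = subst (λ b → b ≡ true ⇔ RRel n (toℕ u) (toℕ v)) (≡sym (rAdj≡ n u v))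
                (does⇔ (qRel? n (toℕ u) (toℕ v) ×-dec ¬? (rPair? n (toℕ u) (toℕ v))))

module Numbering {n : ℕ} (σ : Fin n ↔ Fin n) where
  label : Fin n → ℕ
  label u = toℕ (Inverse.to σ u)

  label-inj : ∀ {x y} → label x ≡ label y → x ≡ y
  label-inj {x} {y} e = trans (≡sym (Inverse.strictlyInverseʳ σ x))
     (trans (cong (Inverse.from σ) (toℕ-injective e)) (Inverse.strictlyInverseʳ σ y))

  label< : ∀ x → label x < n
  label< x = toℕ<n (Inverse.to σ x)

  vertex : (k : ℕ) → k < n → Fin n
  vertex k k<n = Inverse.from σ (fromℕ< k<n)

  label-vertex : ∀ k k<n → label (vertex k k<n) ≡ k
  label-vertex k k<n = trans (cong toℕ (Inverse.strictlyInverseˡ σ (fromℕ< k<n))) (toℕ-fromℕ< k<n)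

  window< : ∀ {k} a → k + a ≤ n → (i : Fin k) → toℕ i + a < n
  window< a k+a≤n i = ≤-trans (+-monoˡ-< a (toℕ<n i)) k+a≤n

  window : ∀ {k} a → k + a ≤ n → Fin k → Fin n
  window a k+a≤n i = vertex (toℕ i + a) (window< a k+a≤n i)

  label-window : ∀ {k} a (k+a≤n : k + a ≤ n) (i : Fin k) → label (window a k+a≤n i) ≡ toℕ i + a
  label-window a k+a≤n i = label-vertex (toℕ i + a) (window< a k+a≤n i)

  window-inj : ∀ {k} a (k+a≤n : k + a ≤ n) → Injective _≡_ _≡_ (window a k+a≤n)
  window-inj a k+a≤n {i} {j} e = toℕ-injective (+-cancelʳ-≡ a (toℕ i) (toℕ j)
    (trans (≡sym (label-window a k+a≤n i)) (trans (cong label e) (label-window a k+a≤n j))))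

module Backward {n : ℕ} (G : Graph n) (σ : Fin n ↔ Fin n) where
  open Numbering σ
  open Moves G

  qLabelling : ∀ {a} → n ≡ 3 + a → (∀ {u v} → Arc G u v → QRel n (label u) (label v)) →
               ∀ {α} → InSG G α → ∀ k → HasCycle α k → k ≤ 2
  qLabelling {a} refl arcRel = QLike.cycles≤2 G a (λ x → m<1+n⇒m≤n (label< x)) edge
    where
    open Labelling label label-inj
    edge : ∀ {p q} → Arc G p q → label q ≡ suc (label p) ⊎ label p ≡ suc (label q) ⊎
             (label p ≡ a × label q ≡ suc (suc a)) ⊎ (label p ≡ suc (suc a) × label q ≡ a)
    edge pq with arcRel pq
    ... | inj₁ (inj₁ up) = inj₁ (≡sym up)
    ... | inj₁ (inj₂ down) = inj₂ (inj₁ (≡sym down))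
    ... | inj₂ (inj₁ (e₁ , e₂)) = inj₂ (inj₂ (inj₁ (suc-injective e₁ , suc-injective e₂)))
    ... | inj₂ (inj₂ (e₁ , e₂)) = inj₂ (inj₂ (inj₂ (suc-injective e₁ , suc-injective e₂)))

  -- In Q_{a+3} the last three vertices form a triangle, which has a 2-cycle.
  twoCycleInQ : ∀ a → n ≡ 3 + a → (∀ u v → QRel n (label u) (label v) → Arc G u v) → CycleIn 2
  twoCycleInQ a refl relArc =
    patternCycle triangle e (window-inj a ≤-refl)
      (arc (inj₁ (inj₁ refl)) ∷ arc (inj₁ (inj₁ refl)) ∷ arc (inj₂ (inj₁ (refl , refl))) ∷ [])
    where
    e : Fin 3 → Fin n
    e = window a ≤-refl
    arc : ∀ {i j} → QRel n (toℕ i + a) (toℕ j + a) → Arc G (e i) (e j)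
    arc {i} {j} r = relArc _ _ (subst₂ (QRel n) (≡sym (label-window a ≤-refl i)) (≡sym (label-window a ≤-refl j)) r)

  -- In R_{b+4} the vertex of label b + 1 is the centre of a star with leaves of
  -- labels b, b + 2, b + 3, which has a 2-cycle.
  twoCycleInR : ∀ b → n ≡ 4 + b →
    (∀ u v → QRel n (label u) (label v) → ¬ RPair n (label u) (label v) → Arc G u v) → CycleIn 2
  twoCycleInR b refl relArc =
    patternCycle star e (window-inj b ≤-refl)
      (arc (inj₁ (inj₁ refl)) (λ { (inj₁ (() , _)) ; (inj₂ (() , _)) }) ∷
       arc (inj₁ (inj₁ refl)) (λ { (inj₁ (() , _)) ; (inj₂ (() , _)) }) ∷
       arc (inj₂ (inj₁ (refl , refl))) (λ { (inj₁ (() , _)) ; (inj₂ (() , _)) }) ∷ [])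
    where
    e : Fin 4 → Fin n
    e = window b ≤-refl
    arc : ∀ {i j} → QRel n (toℕ i + b) (toℕ j + b) → ¬ RPair n (toℕ i + b) (toℕ j + b) → Arc G (e i) (e j)
    arc {i} {j} r nr = relArc _ _
      (subst₂ (QRel n) (≡sym (label-window b ≤-refl i)) (≡sym (label-window b ≤-refl j)) r)
      (nr ∘ subst₂ (RPair n) (label-window b ≤-refl i) (label-window b ≤-refl j))

  ofQ : (∀ u v → adj G u v ≡ qAdj n (Inverse.to σ u) (Inverse.to σ v)) → 3 ≤ n → LEquals G 2
  ofQ iso 3≤n = twoCycleInQ a n≡ (λ u v r → trans (iso u v) (Equivalence.from (qAdj⇔ n _ _) r)) ,
                λ α α∈ → qLabelling n≡ (λ {u} {v} e → Equivalence.to (qAdj⇔ n _ _) (trans (≡sym (iso u v)) e)) α∈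
    where
    a : ℕ
    a = proj₁ (m≤n⇒∃[o]m+o≡n 3≤n)
    n≡ : n ≡ 3 + a
    n≡ = ≡sym (proj₂ (m≤n⇒∃[o]m+o≡n 3≤n))

  -- σ an isomorphism onto R_n (n ≥ 4): l(G) = 2, the arcs of R_n being arcs of Q_n.
  ofR : (∀ u v → adj G u v ≡ rAdj n (Inverse.to σ u) (Inverse.to σ v)) → 4 ≤ n → LEquals G 2
  ofR iso 4≤n = twoCycleInR b n≡ (λ u v r nr → trans (iso u v) (Equivalence.from (rAdj⇔ n _ _) (r , nr))) ,
                λ α α∈ → qLabelling {a = suc b} n≡
                           (λ {u} {v} e → proj₁ (Equivalence.to (rAdj⇔ n _ _) (trans (≡sym (iso u v)) e))) α∈
    where
    b : ℕ
    b = proj₁ (m≤n⇒∃[o]m+o≡n 4≤n)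
    n≡ : n ≡ 4 + b
    n≡ = ≡sym (proj₂ (m≤n⇒∃[o]m+o≡n 4≤n))

backward : ∀ {n} (G : Graph n) → (3 ≤ n × G ≅ qAdj n) ⊎ (4 ≤ n × G ≅ rAdj n) → LEquals G 2
backward G (inj₁ (3≤n , σ , iso)) = Backward.ofQ G σ iso 3≤n
backward G (inj₂ (4≤n , σ , iso)) = Backward.ofR G σ iso 4≤n

prepend : ∀ {A : Set} → A → (ℕ → A) → ℕ → A
prepend x g zero = x
prepend x g (suc i) = g i

-- Paths are sequences q : ℕ → Fin n whose first m terms are distinct and
-- consecutively adjacent (q 0 – q 1 – ⋯ – q (m-1), m vertices).
module Paths {n : ℕ} (G : Graph n) where
  open Moves G

  Distinct : (ℕ → Fin n) → ℕ → Set
  Distinct q m = ∀ i j → i < m → j < m → q i ≡ q j → i ≡ j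

  Linked : (ℕ → Fin n) → ℕ → Set
  Linked q m = ∀ i → suc i < m → Arc G (q i) (q (suc i))

  IsPath : (ℕ → Fin n) → ℕ → Set
  IsPath q m = Distinct q m × Linked q m

  HasPath : ℕ → Set
  HasPath m = Σ (ℕ → Fin n) λ q → IsPath q m

  isPath? : ∀ q m → Dec (IsPath q m)
  isPath? q m = distinct? ×-dec linked?
    where
    distinct? : Dec (Distinct q m)
    distinct? with allUpTo? (λ i → allUpTo? (λ j → (q i F.≟ q j) →-dec (i ℕ.≟ j)) m) m
    ... | yes d = yes λ i j i<m j<m → d i<m j<m
    ... | no ¬d = no λ d → ¬d λ i<m j<m → d _ _ i<m j<m
    linked? : Dec (Linked q m)
    linked? with allUpTo? (λ i → (suc i ℕ.<? m) →-dec arc? (q i) (q (suc i))) m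
    ... | yes l = yes λ i 1+i<m → l (<-trans (n<1+n i) 1+i<m) 1+i<m
    ... | no ¬l = no λ l → ¬l λ _ → l _

  path-local : ∀ m q q' → (∀ i → i < m → q i ≡ q' i) → IsPath q m → IsPath q' m
  path-local m q q' eq (distinct , linked) =
    (λ i j i<m j<m e → distinct i j i<m j<m (trans (eq i i<m) (trans e (≡sym (eq j j<m))))) ,
    (λ i lt → subst₂ (Arc G) (eq i (<-trans (n<1+n i) lt)) (eq (suc i) lt) (linked i lt))

  -- A decidable property of sequences depending only on their first k terms
  -- is decided by trying all k-tuples of vertices (v₀ pads the rest).
  search : Fin n → ∀ k (Q : (ℕ → Fin n) → Set) → (∀ q → Dec (Q q)) →
           (∀ q q' → (∀ i → i < k → q i ≡ q' i) → Q q → Q q') → Dec (Σ _ Q)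
  search v₀ zero Q Q? local with Q? (λ _ → v₀)
  ... | yes h = yes (_ , h)
  ... | no ¬h = no λ { (q , h) → ¬h (local q _ (λ i ()) h) }
  search v₀ (suc k) Q Q? local with FP.any? (λ x → search v₀ k (Q ∘ prepend x) (Q? ∘ prepend x)
                                             (λ g g' eq → local (prepend x g) (prepend x g') (shift eq)))
    where
    shift : ∀ {x g g'} → (∀ i → i < k → g i ≡ g' i) → ∀ i → i < suc k → prepend x g i ≡ prepend x g' i
    shift eq zero _ = refl
    shift eq (suc i) (s≤s lt) = eq i lt
  ... | yes (x , g , h) = yes (prepend x g , h)
  ... | no ¬h = no λ { (q , h) → ¬h (q zero , (q ∘ suc) ,
                        local q (prepend (q zero) (q ∘ suc)) (λ { zero _ → refl ; (suc i) _ → refl }) h) }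

  hasPath? : Fin n → ∀ m → Dec (HasPath m)
  hasPath? v₀ m = search v₀ m (λ q → IsPath q m) (λ q → isPath? q m) (path-local m)

  distinct≤ : ∀ (s : ℕ → Fin n) k → Distinct s k → k ≤ n
  distinct≤ s k distinct with k ℕ.≤? n
  ... | yes k≤n = k≤n
  ... | no k≰n with pigeonhole (≰⇒> k≰n) (s ∘ toℕ)
  ...   | i , j , i<j , e = ⊥-elim (<⇒≢ i<j (distinct (toℕ i) (toℕ j) (toℕ<n i) (toℕ<n j) e))

  injection≤ : ∀ (f : Fin n → ℕ) k → (∀ x → f x < k) → (∀ x y → f x ≡ f y → x ≡ y) → n ≤ k
  injection≤ f k f<k f-inj with n ℕ.≤? k
  ... | yes n≤k = n≤k
  ... | no n≰k with pigeonhole (≰⇒> n≰k) (λ x → fromℕ< (f<k x))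
  ...   | i , j , i<j , e = ⊥-elim (<⇒≢ i<j (cong toℕ (f-inj i j
            (trans (≡sym (toℕ-fromℕ< (f<k i))) (trans (cong toℕ e) (toℕ-fromℕ< (f<k j)))))))

  longestPath : Fin n → Σ ℕ λ m → HasPath m × ¬ HasPath (suc m)
  longestPath v₀ = descend n λ { (q , distinct , _) → <-irrefl refl (distinct≤ q (suc n) distinct) }
    where
    -- from length n + 1, impossible by pigeonhole, down to the first possible one
    descend : ∀ b → ¬ HasPath (suc b) → Σ ℕ λ m → HasPath m × ¬ HasPath (suc m)
    descend zero none = zero , ((λ _ → v₀) , (λ i j ()) , (λ i ())) , none
    descend (suc b) none with hasPath? v₀ (suc b)
    ... | yes p = suc b , p , none
    ... | no ¬p = descend b ¬p

  snoc : (ℕ → Fin n) → ℕ → Fin n → ℕ → Fin n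
  snoc q k y i with i ℕ.<? k
  ... | yes _ = q i
  ... | no _ = y

  snoc-< : ∀ q k y i → i < k → snoc q k y i ≡ q i
  snoc-< q k y i i<k with i ℕ.<? k
  ... | yes _ = refl
  ... | no i≮k = ⊥-elim (i≮k i<k)

  snoc-≥ : ∀ q k y i → k ≤ i → snoc q k y i ≡ y
  snoc-≥ q k y i k≤i with i ℕ.<? k
  ... | yes i<k = ⊥-elim (<⇒≱ i<k k≤i)
  ... | no _ = refl

  snoc-cases : ∀ q k y i → i < suc k → (i < k × snoc q k y i ≡ q i) ⊎ (i ≡ k × snoc q k y i ≡ y)
  snoc-cases q k y i i<1+k with m≤n⇒m<n∨m≡n (m<1+n⇒m≤n i<1+k)
  ... | inj₁ i<k = inj₁ (i<k , snoc-< q k y i i<k)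
  ... | inj₂ i≡k = inj₂ (i≡k , snoc-≥ q k y i (≤-reflexive (≡sym i≡k)))

  Fresh : (ℕ → Fin n) → ℕ → Fin n → Set
  Fresh q k x = ∀ i → i < k → q i ≢ x

  snoc-fresh : ∀ q k y x → Fresh q k x → y ≢ x → Fresh (snoc q k y) (suc k) x
  snoc-fresh q k y x fresh y≢x i i<1+k with snoc-cases q k y i i<1+k
  ... | inj₁ (i<k , e) = subst (_≢ x) (≡sym e) (fresh i i<k)
  ... | inj₂ (_ , e) = subst (_≢ x) (≡sym e) y≢x

  snoc-distinct : ∀ q k y → Distinct q k → Fresh q k y → Distinct (snoc q k y) (suc k)
  snoc-distinct q k y distinct fresh i j i<1+k j<1+k e with snoc-cases q k y i i<1+k | snoc-cases q k y j j<1+k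
  ... | inj₁ (i<k , ei) | inj₁ (j<k , ej) = distinct i j i<k j<k (trans (≡sym ei) (trans e ej))
  ... | inj₁ (i<k , ei) | inj₂ (_ , ej) = ⊥-elim (fresh i i<k (trans (≡sym ei) (trans e ej)))
  ... | inj₂ (_ , ei) | inj₁ (j<k , ej) = ⊥-elim (fresh j j<k (trans (≡sym ej) (trans (≡sym e) ei)))
  ... | inj₂ (i≡k , _) | inj₂ (j≡k , _) = trans i≡k (≡sym j≡k)

  snoc-path : ∀ q k y → IsPath q k → Fresh q k y → (∀ j → suc j ≡ k → Arc G (q j) y) →
              IsPath (snoc q k y) (suc k)
  snoc-path q k y (distinct , linked) fresh last = snoc-distinct q k y distinct fresh , linked'
    where
    linked' : Linked (snoc q k y) (suc k)
    linked' i 1+i<1+k with snoc-cases q k y (suc i) 1+i<1+k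
    ... | inj₁ (1+i<k , e) = subst₂ (Arc G) (≡sym (snoc-< q k y i (<-trans (n<1+n i) 1+i<k))) (≡sym e) (linked i 1+i<k)
    ... | inj₂ (1+i≡k , e) = subst₂ (Arc G) (≡sym (snoc-< q k y i (subst (i <_) 1+i≡k (n<1+n i)))) (≡sym e) (last i 1+i≡k)

  snoc-last : ∀ q k y → snoc q k y k ≡ y
  snoc-last q k y = snoc-≥ q k y k ≤-refl

  extend-path : ∀ q k x y → IsPath q (suc k) → q k ≡ x → Fresh q (suc k) y → Arc G x y →
                IsPath (snoc q (suc k) y) (suc (suc k))
  extend-path q k x y p qk≡x fresh xy =
    snoc-path q (suc k) y p fresh λ { j refl → subst (λ w → Arc G w y) (≡sym qk≡x) xy }

  prefix : ∀ q m k → k ≤ m → IsPath q m → IsPath q k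
  prefix q m k k≤m (distinct , linked) =
    (λ i j i<k j<k → distinct i j (<-≤-trans i<k k≤m) (<-≤-trans j<k k≤m)) ,
    (λ i lt → linked i (<-≤-trans lt k≤m))

  rev : (ℕ → Fin n) → ℕ → ℕ → Fin n
  rev q m i = q (m ∸ suc i)

  rev-< : ∀ m i → i < m → m ∸ suc i < m
  rev-< m i i<m = ∸-monoʳ-< {m} {suc i} {0} (s≤s z≤n) i<m

  rev-rev : ∀ m j → j < m → m ∸ suc (m ∸ suc j) ≡ j
  rev-rev m j j<m = trans (cong (m ∸_) (≡sym (+-∸-assoc 1 j<m))) (m∸[m∸n]≡n (<⇒≤ j<m))

  rev-path : ∀ q m → IsPath q m → IsPath (rev q m) m
  rev-path q m (distinct , linked) = distinct' , linked'
    where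
    distinct' : Distinct (rev q m) m
    distinct' i j i<m j<m e = suc-injective (∸-cancelˡ-≡ i<m j<m (distinct _ _ (rev-< m i i<m) (rev-< m j j<m) e))
    linked' : Linked (rev q m) m
    linked' i 1+i<m = subst (λ z → Arc G (q z) (q (m ∸ suc (suc i)))) eq
                        (arc-sym (linked (m ∸ suc (suc i)) (subst (_< m) (≡sym eq) (rev-< m i (<-trans (n<1+n i) 1+i<m)))))
      where
      eq : suc (m ∸ suc (suc i)) ≡ m ∸ suc i
      eq = ≡sym (+-∸-assoc 1 1+i<m)

  leavingArc : (S : Fin n → Set) → (∀ x → Dec (S x)) → ∀ {x y} → Walk G x y → S x → ¬ S y →
               Σ (Fin n) λ a → Σ (Fin n) λ b → S a × ¬ S b × Arc G a b
  leavingArc S S? here sx ¬sy = ⊥-elim (¬sy sx)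
  leavingArc S S? (step {u} {v} e w) sx ¬sy with S? v
  ... | yes sv = leavingArc S S? w sv ¬sy
  ... | no ¬sv = u , v , sx , ¬sv , e

n<2+n : ∀ i → i < suc (suc i)
n<2+n i = m<n⇒m<1+n (n<1+n i)

n<3+n : ∀ i → i < suc (suc (suc i))
n<3+n i = m<n⇒m<1+n (n<2+n i)

extend : ∀ {k n} → Fin n → (Fin k → Fin n) → Fin (suc k) → Fin n
extend y f fz = y
extend y f (fs i) = f i

extend-inj : ∀ {k n} (y : Fin n) (f : Fin k → Fin n) → Injective _≡_ _≡_ f → (∀ i → f i ≢ y) →
             Injective _≡_ _≡_ (extend y f)
extend-inj y f f-inj fresh {fz} {fz} _ = refl
extend-inj y f f-inj fresh {fz} {fs j} e = ⊥-elim (fresh j (≡sym e))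
extend-inj y f f-inj fresh {fs i} {fz} e = ⊥-elim (fresh i e)
extend-inj y f f-inj fresh {fs i} {fs j} e = cong fs (f-inj e)

module AlongPath {n : ℕ} (G : Graph n) (noThree : ¬ Moves.ThreeCycleIn G)
  (m : ℕ) (q : ℕ → Fin n) (path : Paths.IsPath G q m) where
  open Moves G
  open Paths G

  distinct : Distinct q m
  distinct = proj₁ path

  linked : Linked q m
  linked = proj₂ path

  distinct≢ : ∀ {a b} → a < m → b < m → a ≢ b → q a ≢ q b
  distinct≢ a<m b<m a≢b e = a≢b (distinct _ _ a<m b<m e)

  earlier≢ : ∀ {a b} → a < b → b < m → q a ≢ q b
  earlier≢ a<b b<m = distinct≢ (<-trans a<b b<m) b<m (<⇒≢ a<b)

  later≢ : ∀ {a b} → b < a → a < m → q a ≢ q b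
  later≢ b<a a<m e = earlier≢ b<a a<m (≡sym e)

  OffPath : Fin n → Set
  OffPath x = ∀ k → k < m → q k ≢ x

  Outside : ℕ → ℕ → Fin n → Set
  Outside a b x = ∀ i → a ≤ i → i ≤ b → q i ≢ x

  below-outside : ∀ {a b j} → j < a → b < m → Outside a b (q j)
  below-outside j<a b<m i a≤i i≤b = later≢ (<-≤-trans j<a a≤i) (≤-<-trans i≤b b<m)

  above-outside : ∀ {a b j} → b < j → j < m → Outside a b (q j)
  above-outside b<j j<m i a≤i i≤b = earlier≢ (≤-<-trans i≤b b<j) j<m

  off-outside : ∀ {a b x} → OffPath x → b < m → Outside a b x
  off-outside off b<m i a≤i i≤b = off i (≤-<-trans i≤b b<m)

  walkUp : ∀ i d → d + i < m → Walk G (q i) (q (d + i))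
  walkUp i zero _ = here
  walkUp i (suc d) lt = walkUp i d (<-trans (n<1+n _) lt) ++ʷ step (linked (d + i) lt) here

  walkDown : ∀ i d → d + i < m → Walk G (q (d + i)) (q i)
  walkDown i zero _ = here
  walkDown i (suc d) lt = step (arc-sym (linked (d + i) lt)) (walkDown i d (<-trans (n<1+n _) lt))

  walkUp-avoids : ∀ i d lt {x} → Outside i (d + i) x → Avoids x (walkUp i d lt)
  walkUp-avoids i zero lt out = tt
  walkUp-avoids i (suc d) lt out =
    avoids-++ (walkUp i d _) _ (walkUp-avoids i d _ λ k i≤k k≤d+i → out k i≤k (m≤n⇒m≤1+n k≤d+i))
      (out (d + i) (m≤n+m i d) (n≤1+n _) ∘ ≡sym , tt)

  walkDown-avoids : ∀ i d lt {x} → Outside i (d + i) x → Avoids x (walkDown i d lt)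
  walkDown-avoids i zero lt out = tt
  walkDown-avoids i (suc d) lt out =
    out (suc (d + i)) (m≤n⇒m≤1+n (m≤n+m i d)) ≤-refl ∘ ≡sym ,
    walkDown-avoids i d _ λ k i≤k k≤d+i → out k i≤k (m≤n⇒m≤1+n k≤d+i)

  -- A chord q i – q j with j ≥ i + 3 closes a cycle of length ≥ 4.
  noLongChord : ∀ i j → j < m → suc (suc (suc i)) ≤ j → Arc G (q i) (q j) → ⊥
  noLongChord i j j<m 3+i≤j chord =
    around (subst (_< m) (≡sym j≡) j<m) (subst (λ z → Arc G (q i) (q z)) (≡sym j≡) chord)
    where
    d = j ∸ suc (suc (suc i))
    j≡ : suc d + suc (suc i) ≡ j
    j≡ = trans (≡sym (+-suc d (suc (suc i)))) (m∸n+n≡m 3+i≤j)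
    around : suc d + suc (suc i) < m → Arc G (q i) (q (suc d + suc (suc i))) → ⊥
    around lt e = noThree (longCycle (q i) (q (suc i)) (q (suc (suc i))) (q (suc d + suc (suc i)))
        e (arc-sym (linked i l₁)) (arc-sym (linked (suc i) l₂)) (walkDown (suc (suc i)) (suc d) lt)
        (earlier≢ (n<1+n i) l₁) (earlier≢ (n<1+n (suc i)) l₂) (earlier≢ (n<2+n i) l₂)
        (later≢ (m<n⇒m<1+n (m≤n⇒m≤o+n d (n<1+n (suc i)))) lt) (later≢ (s≤s (m≤n+m _ d)) lt)
        (walkDown-avoids (suc (suc i)) (suc d) lt (below-outside (n<2+n i) lt))
        (walkDown-avoids (suc (suc i)) (suc d) lt (below-outside (n<1+n (suc i)) lt)))
      where
      l₂ : suc (suc i) < m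
      l₂ = ≤-<-trans (m≤n+m _ (suc d)) lt
      l₁ : suc i < m
      l₁ = <-trans (n<1+n _) l₂

  NearArc : ℕ → ℕ → Set
  NearArc i j = j ≡ suc i ⊎ i ≡ suc j ⊎ j ≡ suc (suc i) ⊎ i ≡ suc (suc j)

  arcAlongPath : ∀ i j → i < m → j < m → Arc G (q i) (q j) → NearArc i j
  arcAlongPath i j i<m j<m e with <-cmp i j
  ... | tri≈ _ refl _ = ⊥-elim (arc-≢ e refl)
  ... | tri< i<j _ _ with m≤n⇒m<n∨m≡n i<j
  ...   | inj₂ 1+i≡j = inj₁ (≡sym 1+i≡j)
  ...   | inj₁ 1+i<j with m≤n⇒m<n∨m≡n 1+i<j
  ...     | inj₂ 2+i≡j = inj₂ (inj₂ (inj₁ (≡sym 2+i≡j)))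
  ...     | inj₁ 2+i<j = ⊥-elim (noLongChord i j j<m 2+i<j e)
  arcAlongPath i j i<m j<m e | tri> _ _ j<i with m≤n⇒m<n∨m≡n j<i
  ...   | inj₂ 1+j≡i = inj₂ (inj₁ (≡sym 1+j≡i))
  ...   | inj₁ 1+j<i with m≤n⇒m<n∨m≡n 1+j<i
  ...     | inj₂ 2+j≡i = inj₂ (inj₂ (inj₂ (≡sym 2+j≡i)))
  ...     | inj₁ 2+j<i = ⊥-elim (noLongChord j i i<m 2+j<i (arc-sym e))

  -- A vertex u off the path adjacent to q i and q j with j ≥ i + 2 closes a
  -- cycle of length ≥ 4.
  noOffPathBridge : ∀ u i j → OffPath u → i < m → j < m → suc (suc i) ≤ j → Arc G u (q i) → Arc G u (q j) → ⊥
  noOffPathBridge u i j off i<m j<m 2+i≤j ui uj =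
    around (subst (_< m) (≡sym j≡) j<m) (subst (λ z → Arc G u (q z)) (≡sym j≡) uj)
    where
    d = j ∸ suc (suc i)
    j≡ : suc d + suc i ≡ j
    j≡ = trans (≡sym (+-suc d (suc i))) (m∸n+n≡m 2+i≤j)
    around : suc d + suc i < m → Arc G u (q (suc d + suc i)) → ⊥
    around lt e = noThree (longCycle (q i) u (q (suc d + suc i)) (q (suc i))
        (linked i l₁) ui (arc-sym e) (walkUp (suc i) (suc d) lt)
        (off i i<m) (off _ lt ∘ ≡sym) (earlier≢ (m<n⇒m<1+n (m≤n⇒m≤o+n d (n<1+n i))) lt)
        (off (suc i) l₁) (earlier≢ (s≤s (m≤n+m _ d)) lt)
        (walkUp-avoids (suc i) (suc d) lt (below-outside (n<1+n i) lt))
        (walkUp-avoids (suc i) (suc d) lt (off-outside off lt)))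
      where
      l₁ : suc i < m
      l₁ = ≤-<-trans (m≤n+m _ (suc d)) lt

  record TwoBranches (a b : ℕ) : Set where
    field
      x y s t : Fin n
      xa : Arc G x (q a)
      ya : Arc G y (q a)
      sb : Arc G s (q b)
      tb : Arc G t (q b)
      x≢y : x ≢ y
      x≢s : x ≢ s
      x≢t : x ≢ t
      y≢s : y ≢ s
      y≢t : y ≢ t
      s≢t : s ≢ t
      x-out : Outside a b x
      y-out : Outside a b y
      s-out : Outside a b s
      t-out : Outside a b t

  noTwoBranches : ∀ a b → a ≤ b → b < m → TwoBranches a b → ⊥
  noTwoBranches a b a≤b =
    subst (λ b → b < m → TwoBranches a b → ⊥) (m∸n+n≡m a≤b) (along (b ∸ a))
    where
    along : ∀ d → d + a < m → TwoBranches a (d + a) → ⊥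
    along d d+a<m B = noThree (twoBranches (walkUp a d d+a<m) (walkDown a d d+a<m) x y s t xa ya sb tb
      x≢y x≢s x≢t y≢s y≢t s≢t
      (first x-out) (first y-out) (first s-out) (first t-out)
      (last x-out) (last y-out) (last s-out) (last t-out)
      (walkUp-avoids a d d+a<m x-out) (walkUp-avoids a d d+a<m s-out)
      (walkDown-avoids a d d+a<m y-out) (walkDown-avoids a d d+a<m t-out))
      where
      open TwoBranches B
      first : ∀ {z} → Outside a (d + a) z → z ≢ q a
      first out = out a ≤-refl (m≤n+m a d) ∘ ≡sym
      last : ∀ {z} → Outside a (d + a) z → z ≢ q (d + a)
      last out = out (d + a) (m≤n+m a d) ≤-refl ∘ ≡sym

  Chord : ℕ → Set
  Chord i = suc (suc i) < m × Arc G (q i) (q (suc (suc i)))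

  -- Chords at i and i + 1 close the 4-cycle q (i+1), q (i+3), q (i+2), q i.
  noConsecutiveChords : ∀ i → Chord i → Chord (suc i) → ⊥
  noConsecutiveChords i (l₂ , cᵢ) (l₃ , cᵢ₊₁) =
    noThree (longCycle (q (suc i)) (q i) (q (suc (suc i))) (q (suc (suc (suc i))))
      cᵢ₊₁ (linked i l₁) (arc-sym cᵢ) (step (arc-sym (linked (suc (suc i)) l₃)) here)
      (later≢ (n<1+n i) l₁) (earlier≢ (n<2+n i) l₂) (earlier≢ (n<1+n _) l₂)
      (later≢ (n<3+n i) l₃) (later≢ (n<1+n _) l₃)
      (earlier≢ (n<2+n _) l₃ , tt) (earlier≢ (n<3+n _) l₃ , tt))
    where
    l₁ : suc i < m
    l₁ = <-trans (n<1+n _) l₂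

  -- Chords at i and j ≥ i + 2: q (i+2) and q j are two branch vertices.
  noDistantChords : ∀ i j → suc (suc i) ≤ j → Chord i → Chord j → ⊥
  noDistantChords i j 2+i≤j (l₂ , ci) (j+2<m , cj) = noTwoBranches (suc (suc i)) j 2+i≤j j<m record
    { x = q (suc i) ; y = q i ; s = q (suc j) ; t = q (suc (suc j))
    ; xa = linked (suc i) l₂ ; ya = ci ; sb = arc-sym (linked j j+1<m) ; tb = arc-sym cj
    ; x≢y = later≢ (n<1+n i) (<-trans (n<1+n _) l₂)
    ; x≢s = earlier≢ (s≤s (≤-trans (n≤1+n _) 2+i≤j)) j+1<m
    ; x≢t = earlier≢ (<-trans (s≤s (≤-trans (n≤1+n _) 2+i≤j)) (n<1+n _)) j+2<m
    ; y≢s = earlier≢ (s≤s (≤-trans (n≤1+n _) (≤-trans (n≤1+n _) 2+i≤j))) j+1<m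
    ; y≢t = earlier≢ (<-trans (s≤s (≤-trans (n≤1+n _) (≤-trans (n≤1+n _) 2+i≤j))) (n<1+n _)) j+2<m
    ; s≢t = earlier≢ (n<1+n _) j+2<m
    ; x-out = below-outside (n<1+n _) j<m ; y-out = below-outside (n<2+n _) j<m
    ; s-out = above-outside (n<1+n j) j+1<m ; t-out = above-outside (n<2+n j) j+2<m
    }
    where
    j+1<m : suc j < m
    j+1<m = <-trans (n<1+n _) j+2<m
    j<m : j < m
    j<m = <-trans (n<1+n _) j+1<m

  noTwoChords : ∀ i j → Chord i → Chord j → i < j → ⊥
  noTwoChords i j ci cj i<j with m≤n⇒m<n∨m≡n i<j
  ... | inj₂ refl = noConsecutiveChords i ci cj
  ... | inj₁ 2+i≤j = noDistantChords i j 2+i≤j ci cj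

  pathWindow : ∀ i {k} → k + i ≤ m → Fin k → Fin n
  pathWindow i k+i≤m j = q (toℕ j + i)

  pathWindow< : ∀ i {k} → k + i ≤ m → (j : Fin k) → toℕ j + i < m
  pathWindow< i k+i≤m j = ≤-trans (+-monoˡ-< i (toℕ<n j)) k+i≤m

  pathWindow-inj : ∀ i {k} (k+i≤m : k + i ≤ m) → Injective _≡_ _≡_ (pathWindow i k+i≤m)
  pathWindow-inj i k+i≤m {a} {b} e = toℕ-injective (+-cancelʳ-≡ i (toℕ a) (toℕ b)
    (distinct _ _ (pathWindow< i k+i≤m a) (pathWindow< i k+i≤m b) e))

  bullFree : ∀ i → suc (suc (suc (suc i))) < m → Arc G (q (suc i)) (q (suc (suc (suc i)))) → ⊥
  bullFree i l₄ chord = noThree (patternCycle bull (pathWindow i l₄) (pathWindow-inj i l₄)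
    (linked i l₁ ∷ linked (suc i) l₂ ∷ linked (suc (suc i)) l₃ ∷ linked (suc (suc (suc i))) l₄ ∷ chord ∷ []))
    where
    l₃ : suc (suc (suc i)) < m
    l₃ = <-trans (n<1+n _) l₄
    l₂ : suc (suc i) < m
    l₂ = <-trans (n<1+n _) l₃
    l₁ : suc i < m
    l₁ = <-trans (n<1+n _) l₂

  spiderFree : ∀ i y → OffPath y → suc (suc (suc (suc i))) < m → Arc G y (q (suc (suc i))) → ⊥
  spiderFree i y off l₄ yq = noThree (patternCycle spider (extend y (pathWindow i l₄))
    (extend-inj y (pathWindow i l₄) (pathWindow-inj i l₄) (λ j → off _ (pathWindow< i l₄ j)))
    (linked i l₁ ∷ linked (suc i) l₂ ∷ linked (suc (suc i)) l₃ ∷ linked (suc (suc (suc i))) l₄ ∷ yq ∷ []))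
    where
    l₃ : suc (suc (suc i)) < m
    l₃ = <-trans (n<1+n _) l₄
    l₂ : suc (suc i) < m
    l₂ = <-trans (n<1+n _) l₃
    l₁ : suc i < m
    l₁ = <-trans (n<1+n _) l₂

isoFromNumbering : ∀ {n} (G : Graph n) (H : Fin n → Fin n → Bool) (R : ℕ → ℕ → Set)
  (ℓ : Fin n → ℕ) (ℓ< : ∀ x → ℓ x < n) (vertexAt : ℕ → Fin n) →
  (∀ x → vertexAt (ℓ x) ≡ x) → (∀ k → k < n → ℓ (vertexAt k) ≡ k) →
  (∀ u v → Arc G u v ⇔ R (ℓ u) (ℓ v)) → (∀ u v → H u v ≡ true ⇔ R (toℕ u) (toℕ v)) → G ≅ H
isoFromNumbering {n} G H R ℓ ℓ< vertexAt vertexAt-ℓ ℓ-vertexAt arc⇔ H⇔ =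
  σ , λ u v → ⇔→≡ (mk⇔ (arc→ u v) (arc← u v))
  where
  number : Fin n → Fin n
  number x = fromℕ< (ℓ< x)
  toℕ-number : ∀ x → ℓ x ≡ toℕ (number x)
  toℕ-number x = ≡sym (toℕ-fromℕ< (ℓ< x))
  σ : Fin n ↔ Fin n
  σ = mk↔ₛ′ number (vertexAt ∘ toℕ)
        (λ y → toℕ-injective (trans (toℕ-fromℕ< _) (ℓ-vertexAt (toℕ y) (toℕ<n y))))
        (λ x → trans (cong vertexAt (toℕ-fromℕ< (ℓ< x))) (vertexAt-ℓ x))
  arc→ : ∀ u v → Arc G u v → H (number u) (number v) ≡ true
  arc→ u v = Equivalence.from (H⇔ _ _) ∘ subst₂ R (toℕ-number u) (toℕ-number v) ∘ Equivalence.to (arc⇔ u v)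
  arc← : ∀ u v → H (number u) (number v) ≡ true → Arc G u v
  arc← u v = Equivalence.from (arc⇔ u v) ∘ subst₂ R (≡sym (toℕ-number u)) (≡sym (toℕ-number v))
            ∘ Equivalence.to (H⇔ _ _)

module LongestPath {n : ℕ} (G : Graph n) (noThree : ¬ Moves.ThreeCycleIn G) (conn : Connected G)
  (m : ℕ) (q : ℕ → Fin n) (path : Paths.IsPath G q m) (longest : ¬ Paths.HasPath G (suc m)) where
  open Moves G
  open Paths G
  open AlongPath G noThree m q path public

  OnPath : Fin n → Set
  OnPath x = Σ ℕ λ i → i < m × q i ≡ x

  onPath? : ∀ x → Dec (OnPath x)
  onPath? x = anyUpTo? (λ i → q i F.≟ x) m

  notOn⇒off : ∀ {x} → ¬ OnPath x → OffPath x
  notOn⇒off notOn i i<m e = notOn (i , i<m , e)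

  fresh-on : ∀ k j → k ≤ j → j < m → Fresh q k (q j)
  fresh-on k j k≤j j<m i i<k = earlier≢ (<-≤-trans i<k k≤j) j<m

  fresh-off : ∀ k x → k ≤ m → OffPath x → Fresh q k x
  fresh-off k x k≤m off i i<k = off i (<-≤-trans i<k k≤m)

  lastEnd-closed : ∀ b → OffPath b → ∀ j → suc j ≡ m → Arc G (q j) b → ⊥
  lastEnd-closed b off j 1+j≡m e = longest (snoc q m b , snoc-path q m b path off
    (λ j' 1+j'≡m → subst (λ w → Arc G (q w) b) (suc-injective (trans 1+j≡m (≡sym 1+j'≡m))) e))

  firstEnd-closed : ∀ b → OffPath b → Arc G (q 0) b → ⊥
  firstEnd-closed b off e = longest (snoc (rev q m) m b , snoc-path (rev q m) m b (rev-path q m path)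
    (λ i i<m → off _ (rev-< m i i<m))
    (λ j 1+j≡m → subst (λ w → Arc G (q w) b) (≡sym (trans (cong (m ∸_) 1+j≡m) (n∸n≡0 m))) e))

  module Pendant (k : ℕ) (m≡ : m ≡ 3 + k) (u : Fin n) (off : OffPath u) (uc : Arc G u (q (suc k))) where
    c : Fin n
    c = q (suc k)
    l₂ : suc (suc k) < m
    l₂ = subst (suc (suc k) <_) (≡sym m≡) (n<1+n _)
    l₁ : suc k < m
    l₁ = <-trans (n<1+n _) l₂
    l₀ : k < m
    l₀ = <-trans (n<1+n _) l₁

    tooLong : ∀ q' → IsPath q' (4 + k) → ⊥
    tooLong q' p = longest (q' , subst (λ z → IsPath q' (suc z)) (≡sym m≡) p)

    prefixPath : ∀ j → j ≤ 3 + k → IsPath q j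
    prefixPath j j≤ = prefix q m j (subst (j ≤_) (≡sym m≡) j≤) path

    throughU : IsPath (snoc q (2 + k) u) (3 + k)
    throughU = extend-path q (suc k) c u (prefixPath _ (n≤1+n _)) refl (fresh-off _ u (<⇒≤ l₂) off) (arc-sym uc)

    -- u has no neighbour z off the path: q 0, …, q (k+1), u, z would be longer.
    offNeighbour : ∀ z → OffPath z → Arc G u z → ⊥
    offNeighbour z offz uz = tooLong _ (extend-path (snoc q (2 + k) u) (2 + k) u z throughU (snoc-last q (2 + k) u)
        (snoc-fresh q _ u z (fresh-off _ z (<⇒≤ l₂) offz) (arc-≢ uz)) uz)

    -- u is not adjacent to q (k+2): q 0, …, q (k+1), u, q (k+2) would be longer.
    afterNeighbour : Arc G u (q (2 + k)) → ⊥
    afterNeighbour uq = tooLong _ (extend-path (snoc q (2 + k) u) (2 + k) u _ throughU (snoc-last q (2 + k) u)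
        (snoc-fresh q _ u _ (fresh-on _ _ ≤-refl l₂) (off _ l₂ ∘ ≡sym)) uq)

    -- u is not adjacent to q k: q 0, …, q k, u, c, q (k+2) would be longer.
    beforeNeighbour : Arc G u (q k) → ⊥
    beforeNeighbour uq = tooLong _ (extend-path q₂ (2 + k) c (q (2 + k)) p₂ (snoc-last q₁ (2 + k) c)
        (snoc-fresh q₁ _ c _ (snoc-fresh q _ u _ (fresh-on _ _ (n≤1+n _) l₂) (off _ l₂ ∘ ≡sym)) (earlier≢ (n<1+n _) l₂))
        (linked (suc k) l₂))
      where
      q₁ q₂ : ℕ → Fin n
      q₁ = snoc q (1 + k) u
      q₂ = snoc q₁ (2 + k) c
      p₁ : IsPath q₁ (2 + k)
      p₁ = extend-path q k (q k) u (prefixPath _ (m≤n⇒m≤1+n (n≤1+n _))) refl (fresh-off _ u l₀ off) (arc-sym uq)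
      p₂ : IsPath q₂ (3 + k)
      p₂ = extend-path q₁ (1 + k) u c p₁ (snoc-last q (1 + k) u)
             (snoc-fresh q _ u c (fresh-on _ _ ≤-refl l₁) (off _ l₁ ∘ ≡sym)) uc

    leaf : ∀ z → Arc G u z → z ≡ c
    leaf z uz with onPath? z
    ... | no notOn = ⊥-elim (offNeighbour z (notOn⇒off notOn) uz)
    ... | yes (j , j<m , refl) with <-cmp j (suc k)
    ...   | tri≈ _ refl _ = refl
    ...   | tri< j<1+k _ _ with m≤n⇒m<n∨m≡n j<1+k
    ...     | inj₁ 2+j≤1+k = ⊥-elim (noOffPathBridge u j (suc k) off j<m l₁ 2+j≤1+k uz uc)
    ...     | inj₂ refl = ⊥-elim (beforeNeighbour uz)
    leaf z uz | yes (j , j<m , refl) | tri> _ _ 1+k<j with m≤n⇒m<n∨m≡n 1+k<j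
    ...     | inj₁ 2+k<j = ⊥-elim (<⇒≱ j<m (subst (_≤ j) (≡sym m≡) 2+k<j))
    ...     | inj₂ refl = ⊥-elim (afterNeighbour uz)

    -- c has no neighbour off the path other than u: with q k, u, q (k+2) it
    -- would be a vertex of degree four.
    degreeThree : ∀ b → OffPath b → b ≢ u → Arc G c b → ⊥
    degreeThree b offb b≢u cb = noTwoBranches (suc k) (suc k) ≤-refl l₁ record
      { x = q k ; y = u ; s = q (2 + k) ; t = b
      ; xa = linked k l₁ ; ya = uc ; sb = arc-sym (linked (suc k) l₂) ; tb = arc-sym cb
      ; x≢y = off k l₀ ; x≢s = earlier≢ (n<2+n k) l₂ ; x≢t = offb k l₀
      ; y≢s = off _ l₂ ∘ ≡sym ; y≢t = b≢u ∘ ≡sym ; s≢t = offb _ l₂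
      ; x-out = below-outside (n<1+n k) l₁ ; y-out = off-outside off l₁
      ; s-out = above-outside (n<1+n _) l₂ ; t-out = off-outside offb l₁
      }

    -- No q (j+1) with j < k has a neighbour b off the path other than u: q (j+1)
    -- and c would be two branch vertices.
    secondBranch : ∀ j b → OffPath b → b ≢ u → suc j < suc k → Arc G (q (suc j)) b → ⊥
    secondBranch j b offb b≢u 1+j<1+k qb = noTwoBranches (suc j) (suc k) (<⇒≤ 1+j<1+k) l₁ record
      { x = q j ; y = b ; s = u ; t = q (2 + k)
      ; xa = linked j (<-trans 1+j<1+k l₁) ; ya = arc-sym qb ; sb = uc ; tb = arc-sym (linked (suc k) l₂)
      ; x≢y = offb j j<m ; x≢s = off j j<m
      ; x≢t = earlier≢ (<-trans (<-trans (n<1+n j) 1+j<1+k) (n<1+n _)) l₂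
      ; y≢s = b≢u ; y≢t = offb _ l₂ ∘ ≡sym ; s≢t = off _ l₂ ∘ ≡sym
      ; x-out = below-outside (n<1+n j) l₁ ; y-out = off-outside offb l₁
      ; s-out = off-outside off l₁ ; t-out = above-outside (n<1+n _) l₂
      }
      where
      j<m : j < m
      j<m = <-trans (<-trans (n<1+n j) 1+j<1+k) l₁

    -- Every vertex lies on the path or is u: no arc leaves this set.
    OnPath∪u : Fin n → Set
    OnPath∪u x = OnPath x ⊎ x ≡ u

    noExit : ∀ a b → OnPath∪u a → ¬ OnPath∪u b → Arc G a b → ⊥
    noExit a b (inj₂ refl) ¬b ab = ¬b (inj₁ (suc k , l₁ , ≡sym (leaf b ab)))
    noExit a b (inj₁ (j , j<m , refl)) ¬b ab = fromPath j j<m ab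
      where
      offb : OffPath b
      offb i i<m e = ¬b (inj₁ (i , i<m , e))
      b≢u : b ≢ u
      b≢u = ¬b ∘ inj₂
      fromPath : ∀ j → j < m → Arc G (q j) b → ⊥
      fromPath zero _ qb = firstEnd-closed b offb qb
      fromPath (suc j) j<m qb with <-cmp (suc j) (suc k)
      ... | tri< 1+j<1+k _ _ = secondBranch j b offb b≢u 1+j<1+k qb
      ... | tri≈ _ refl _ = degreeThree b offb b≢u qb
      ... | tri> _ _ 1+k<1+j with m≤n⇒m<n∨m≡n 1+k<1+j
      ...   | inj₁ 2+k<1+j = <⇒≱ j<m (subst (_≤ suc j) (≡sym m≡) 2+k<1+j)
      ...   | inj₂ refl = lastEnd-closed b offb (suc (suc k)) (≡sym m≡) qb

    covered : ∀ x → OnPath∪u x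
    covered x with onPath? x ⊎-dec (x F.≟ u)
    ... | yes x∈ = x∈
    ... | no x∉ with leavingArc OnPath∪u (λ y → onPath? y ⊎-dec (y F.≟ u)) (conn u x) (inj₂ refl) x∉
    ...   | a , b , a∈ , b∉ , ab = ⊥-elim (noExit a b a∈ b∉ ab)

    -- There is no chord: one at k gives the longer path q 0, …, q k, q (k+2), c, u,
    chordAtEnd : Chord k → ⊥
    chordAtEnd (_ , chord) = tooLong _ (extend-path q₂ (2 + k) c u p₂ (snoc-last q₁ (2 + k) c)
        (snoc-fresh q₁ _ c u (snoc-fresh q _ _ u (fresh-off _ u l₀ off) (off _ l₂)) (off _ l₁)) (arc-sym uc))
      where
      q₁ q₂ : ℕ → Fin n
      q₁ = snoc q (1 + k) (q (2 + k))
      q₂ = snoc q₁ (2 + k) c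
      p₁ : IsPath q₁ (2 + k)
      p₁ = extend-path q k (q k) (q (2 + k)) (prefixPath _ (m≤n⇒m≤1+n (n≤1+n _))) refl
             (fresh-on _ _ (n≤1+n _) l₂) chord
      p₂ : IsPath q₂ (3 + k)
      p₂ = extend-path q₁ (1 + k) (q (2 + k)) c p₁ (snoc-last q (1 + k) (q (2 + k)))
             (snoc-fresh q _ _ c (fresh-on _ _ ≤-refl l₁) (later≢ (n<1+n _) l₂)) (arc-sym (linked (suc k) l₂))

    -- … and a chord at j < k makes q (j+2) and c two branch vertices.
    chordBefore : ∀ j → j < k → Chord j → ⊥
    chordBefore j j<k (j+2<m , chord) = noTwoBranches (suc (suc j)) (suc k) (s≤s j<k) l₁ record
      { x = q (suc j) ; y = q j ; s = u ; t = q (2 + k)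
      ; xa = linked (suc j) j+2<m ; ya = chord ; sb = uc ; tb = arc-sym (linked (suc k) l₂)
      ; x≢y = later≢ (n<1+n j) (<-trans (n<1+n _) j+2<m) ; x≢s = off _ (<-trans (n<1+n _) j+2<m)
      ; x≢t = earlier≢ (s≤s (≤-trans (n≤1+n _) (s≤s j<k))) l₂
      ; y≢s = off j (<-trans (n<2+n j) j+2<m) ; y≢t = earlier≢ (<-trans (n<2+n j) (s≤s (s≤s j<k))) l₂
      ; s≢t = off _ l₂ ∘ ≡sym
      ; x-out = below-outside (n<1+n _) l₁ ; y-out = below-outside (n<2+n j) l₁
      ; s-out = off-outside off l₁ ; t-out = above-outside (n<1+n _) l₂
      }

    noChord : ∀ j → Chord j → ⊥
    noChord j ch with <-cmp j k
    ... | tri< j<k _ _ = chordBefore j j<k ch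
    ... | tri≈ _ refl _ = chordAtEnd ch
    ... | tri> _ _ k<j = <⇒≱ (proj₁ ch) (subst (_≤ suc (suc j)) (≡sym m≡) (s≤s (s≤s k<j)))

    -- Numbering q i by i and u by M = 3 + k is an isomorphism onto R_N, N = 4 + k.
    M N : ℕ
    M = 3 + k
    N = 4 + k

    position′ : ∀ {x} → OnPath∪u x → ℕ
    position′ (inj₁ (i , _)) = i
    position′ (inj₂ _) = M

    position : Fin n → ℕ
    position x = position′ (covered x)

    View : Fin n → Set
    View x = (Σ ℕ λ a → a < m × q a ≡ x × position x ≡ a) ⊎ (u ≡ x × position x ≡ M)

    view : ∀ x → View x
    view x with covered x
    ... | inj₁ (i , i<m , e) = inj₁ (i , i<m , e , refl)
    ... | inj₂ e = inj₂ (≡sym e , refl)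

    <m⇒<M : ∀ {a} → a < m → a < M
    <m⇒<M {a} = subst (a <_) m≡

    position≤M : ∀ x → position x < suc M
    position≤M x with view x
    ... | inj₁ (a , a<m , _ , e) = subst (_< suc M) (≡sym e) (m<n⇒m<1+n (<m⇒<M a<m))
    ... | inj₂ (_ , e) = subst (_< suc M) (≡sym e) (n<1+n M)

    position-inj : ∀ x y → position x ≡ position y → x ≡ y
    position-inj x y e with view x | view y
    ... | inj₁ (a , a<m , refl , ea) | inj₁ (b , b<m , refl , eb) = cong q (trans (≡sym ea) (trans e eb))
    ... | inj₁ (a , a<m , _ , ea) | inj₂ (_ , eb) = ⊥-elim (<⇒≢ (<m⇒<M a<m) (trans (≡sym ea) (trans e eb)))
    ... | inj₂ (_ , ea) | inj₁ (b , b<m , _ , eb) = ⊥-elim (<⇒≢ (<m⇒<M b<m) (trans (≡sym eb) (trans (≡sym e) ea)))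
    ... | inj₂ (refl , _) | inj₂ (refl , _) = refl

    -- n = 4 + k: the numbering is injective into {0, …, 3 + k} and the path
    -- together with u has 4 + k distinct vertices.
    n≡N : n ≡ N
    n≡N = ≤-antisym (injection≤ position N position≤M position-inj)
            (subst (_≤ n) (cong suc m≡) (distinct≤ (snoc q m u) (suc m) (snoc-distinct q m u distinct off)))

    position< : ∀ x → position x < n
    position< x = subst (position x <_) (≡sym n≡N) (position≤M x)

    vertexAt-position : ∀ x → snoc q m u (position x) ≡ x
    vertexAt-position x with view x
    ... | inj₁ (a , a<m , e , pa) = trans (cong (snoc q m u) pa) (trans (snoc-< q m u a a<m) e)
    ... | inj₂ (e , pu) = trans (cong (snoc q m u) pu) (trans (snoc-≥ q m u M (≤-reflexive m≡)) e)

    position-q : ∀ a → a < m → position (q a) ≡ a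
    position-q a a<m with view (q a)
    ... | inj₁ (b , b<m , e , pb) = trans pb (distinct b a b<m a<m e)
    ... | inj₂ (e , _) = ⊥-elim (off a a<m (≡sym e))

    position-u : position u ≡ M
    position-u with view u
    ... | inj₁ (b , b<m , e , _) = ⊥-elim (off b b<m e)
    ... | inj₂ (_ , pu) = pu

    position-vertexAt : ∀ j → j < n → position (snoc q m u j) ≡ j
    position-vertexAt j j<n with snoc-cases q m u j (subst (j <_) (trans n≡N (cong suc (≡sym m≡))) j<n)
    ... | inj₁ (j<m , e) = trans (cong position e) (position-q j j<m)
    ... | inj₂ (j≡m , e) = trans (cong position e) (trans position-u (≡sym (trans j≡m m≡)))

    -- Arcs between path vertices: there are no chords, so these are the path edges.
    pathArc⇔ : ∀ a b → a < m → b < m → Arc G (q a) (q b) ⇔ RRel N a b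
    pathArc⇔ a b a<m b<m = mk⇔ to from
      where
      notLast : ¬ RPair N a b
      notLast (inj₁ (_ , e)) = <⇒≢ (<m⇒<M b<m) (suc-injective e)
      notLast (inj₂ (e , _)) = <⇒≢ (<m⇒<M a<m) (suc-injective e)
      to : Arc G (q a) (q b) → RRel N a b
      to e with arcAlongPath a b a<m b<m e
      ... | inj₁ b≡1+a = inj₁ (inj₁ (≡sym b≡1+a)) , notLast
      ... | inj₂ (inj₁ a≡1+b) = inj₁ (inj₂ (≡sym a≡1+b)) , notLast
      ... | inj₂ (inj₂ (inj₁ refl)) = ⊥-elim (noChord a (b<m , e))
      ... | inj₂ (inj₂ (inj₂ refl)) = ⊥-elim (noChord b (a<m , arc-sym e))
      from : RRel N a b → Arc G (q a) (q b)
      from (inj₁ (inj₁ refl) , _) = linked a b<m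
      from (inj₁ (inj₂ refl) , _) = arc-sym (linked b a<m)
      from (inj₂ (inj₁ (_ , e)) , _) = ⊥-elim (<⇒≢ (<m⇒<M b<m) (suc-injective e))
      from (inj₂ (inj₂ (e , _)) , _) = ⊥-elim (<⇒≢ (<m⇒<M a<m) (suc-injective e))

    pendantArc⇔ : ∀ a → a < m → Arc G (q a) u ⇔ RRel N a M
    pendantArc⇔ a a<m = mk⇔ to from
      where
      to : Arc G (q a) u → RRel N a M
      to e with distinct a (suc k) a<m l₁ (leaf (q a) (arc-sym e))
      ... | refl = inj₂ (inj₁ (refl , refl)) , λ { (inj₁ (() , _)) ; (inj₂ (() , _)) }
      from : RRel N a M → Arc G (q a) u
      from (inj₁ (inj₁ 1+a≡M) , notPair) = ⊥-elim (notPair (inj₁ (1+a≡M , refl)))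
      from (inj₁ (inj₂ 1+M≡a) , _) = ⊥-elim (<-asym (<m⇒<M a<m) (≤-reflexive 1+M≡a))
      from (inj₂ (inj₁ (1+a≡2+k , _)) , _) = subst (λ i → Arc G (q i) u) (≡sym (suc-injective 1+a≡2+k)) (arc-sym uc)
      from (inj₂ (inj₂ (1+a≡N , _)) , _) = ⊥-elim (<⇒≢ (<m⇒<M a<m) (suc-injective 1+a≡N))

    loop⇔ : Arc G u u ⇔ RRel N M M
    loop⇔ = mk⇔ (λ e → ⊥-elim (arc-≢ e refl))
      λ { (inj₁ (inj₁ ()) , _) ; (inj₁ (inj₂ ()) , _) ; (inj₂ (inj₁ (() , _)) , _) ; (inj₂ (inj₂ (_ , ())) , _) }

    arc⇔ : ∀ x y → Arc G x y ⇔ RRel n (position x) (position y)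
    arc⇔ x y = subst (λ n′ → Arc G x y ⇔ RRel n′ (position x) (position y)) (≡sym n≡N) (byView (view x) (view y))
      where
      byView : View x → View y → Arc G x y ⇔ RRel N (position x) (position y)
      byView (inj₁ (a , a<m , refl , pa)) (inj₁ (b , b<m , refl , pb)) =
        subst₂ (λ i j → Arc G x y ⇔ RRel N i j) (≡sym pa) (≡sym pb) (pathArc⇔ a b a<m b<m)
      byView (inj₁ (a , a<m , refl , pa)) (inj₂ (refl , pu)) =
        subst₂ (λ i j → Arc G x y ⇔ RRel N i j) (≡sym pa) (≡sym pu) (pendantArc⇔ a a<m)
      byView (inj₂ (refl , pu)) (inj₁ (b , b<m , refl , pb)) =
        subst₂ (λ i j → Arc G x y ⇔ RRel N i j) (≡sym pu) (≡sym pb)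
          (mk⇔ (λ e → RRel-swap (Equivalence.to (pendantArc⇔ b b<m) (arc-sym e)))
               (λ r → arc-sym (Equivalence.from (pendantArc⇔ b b<m) (RRel-swap r))))
      byView (inj₂ (refl , pu)) (inj₂ (refl , pu′)) =
        subst₂ (λ i j → Arc G x y ⇔ RRel N i j) (≡sym pu) (≡sym pu′) loop⇔

    isoR : 4 ≤ n × G ≅ rAdj n
    isoR = subst (4 ≤_) (≡sym n≡N) (s≤s (s≤s (s≤s (s≤s z≤n)))) ,
           isoFromNumbering G (rAdj n) (RRel n) position position< (snoc q m u)
             vertexAt-position position-vertexAt arc⇔ (rAdj⇔ n)

  chord? : ∀ i → Dec (Chord i)
  chord? i = (suc (suc i) ℕ.<? m) ×-dec arc? (q i) (q (suc (suc i)))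

  module Covering (allOn : ∀ x → OnPath x) where
    position : Fin n → ℕ
    position x = proj₁ (allOn x)

    position<m : ∀ x → position x < m
    position<m x = proj₁ (proj₂ (allOn x))

    q-position : ∀ x → q (position x) ≡ x
    q-position x = proj₂ (proj₂ (allOn x))

    position-q : ∀ a → a < m → position (q a) ≡ a
    position-q a a<m = distinct _ _ (position<m (q a)) a<m (q-position (q a))

    position-inj : ∀ {x y} → position x ≡ position y → x ≡ y
    position-inj {x} {y} e = trans (≡sym (q-position x)) (trans (cong q e) (q-position y))

    n≡m : n ≡ m
    n≡m = ≤-antisym (injection≤ position m position<m (λ x y → position-inj)) (distinct≤ q m distinct)

    arcAt : ∀ {x y} → Arc G x y → Arc G (q (position x)) (q (position y))
    arcAt {x} {y} = subst₂ (Arc G) (≡sym (q-position x)) (≡sym (q-position y))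

    -- Without chords every edge joins consecutive positions: G is a path,
    -- which has no 2-cycle.
    chordless : (∀ i → ¬ Chord i) → ¬ CycleIn 2
    chordless noChord (α , α∈ , cyc) = PathLike.noTwoCycle G edge α∈ cyc
      where
      open Labelling position position-inj
      edge : ∀ {x y} → Arc G x y → position y ≡ suc (position x) ⊎ position x ≡ suc (position y)
      edge {x} {y} e with arcAlongPath (position x) (position y) (position<m x) (position<m y) (arcAt e)
      ... | inj₁ up = inj₁ up
      ... | inj₂ (inj₁ down) = inj₂ down
      ... | inj₂ (inj₂ (inj₁ 2+x≡y)) = ⊥-elim (noChord (position x)
              (subst (_< m) 2+x≡y (position<m y) , subst (λ z → Arc G (q (position x)) (q z)) 2+x≡y (arcAt e)))
      ... | inj₂ (inj₂ (inj₂ 2+y≡x)) = ⊥-elim (noChord (position y)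
              (subst (_< m) 2+y≡x (position<m x) , subst (λ z → Arc G (q (position y)) (q z)) 2+y≡x (arcAt (arc-sym e))))

    module _ (k : ℕ) (m≡ : m ≡ 3 + k) (chord : Chord k) where
      M : ℕ
      M = 3 + k

      uniqueChord : ∀ j → Chord j → j ≡ k
      uniqueChord j cj with <-cmp j k
      ... | tri< j<k _ _ = ⊥-elim (noTwoChords j k cj chord j<k)
      ... | tri≈ _ j≡k _ = j≡k
      ... | tri> _ _ k<j = ⊥-elim (noTwoChords k j chord cj k<j)

      pathArc⇔ : ∀ a b → a < m → b < m → Arc G (q a) (q b) ⇔ QRel M a b
      pathArc⇔ a b a<m b<m = mk⇔ to from
        where
        to : Arc G (q a) (q b) → QRel M a b
        to e with arcAlongPath a b a<m b<m e
        ... | inj₁ b≡1+a = inj₁ (inj₁ (≡sym b≡1+a))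
        ... | inj₂ (inj₁ a≡1+b) = inj₁ (inj₂ (≡sym a≡1+b))
        ... | inj₂ (inj₂ (inj₁ refl)) with uniqueChord a (b<m , e)
        ...   | refl = inj₂ (inj₁ (refl , refl))
        to e | inj₂ (inj₂ (inj₂ refl)) with uniqueChord b (a<m , arc-sym e)
        ...   | refl = inj₂ (inj₂ (refl , refl))
        from : QRel M a b → Arc G (q a) (q b)
        from (inj₁ (inj₁ refl)) = linked a b<m
        from (inj₁ (inj₂ refl)) = arc-sym (linked b a<m)
        from (inj₂ (inj₁ (e₁ , e₂))) with suc-injective e₁ | suc-injective e₂
        ... | refl | refl = proj₂ chord
        from (inj₂ (inj₂ (e₁ , e₂))) with suc-injective e₁ | suc-injective e₂
        ... | refl | refl = arc-sym (proj₂ chord)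

      n≡M : n ≡ M
      n≡M = trans n≡m m≡

      arc⇔ : ∀ x y → Arc G x y ⇔ QRel n (position x) (position y)
      arc⇔ x y = subst (λ n′ → Arc G x y ⇔ QRel n′ (position x) (position y)) (≡sym n≡M)
        (mk⇔ (Equivalence.to (pathArc⇔ _ _ (position<m x) (position<m y)) ∘ arcAt)
             (subst₂ (Arc G) (q-position x) (q-position y) ∘ Equivalence.from (pathArc⇔ _ _ (position<m x) (position<m y))))

      isoQ : 3 ≤ n × G ≅ qAdj n
      isoQ = subst (3 ≤_) (≡sym n≡M) (s≤s (s≤s (s≤s z≤n))) ,
             isoFromNumbering G (qAdj n) (QRel n) position (λ x → subst (position x <_) (≡sym n≡m) (position<m x)) q
               q-position (λ j j<n → position-q j (subst (j <_) n≡m j<n)) arc⇔ (qAdj⇔ n)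

module Forward {n : ℕ} (G : Graph n) (conn : Connected G) (l≡2 : LEquals G 2) where
  open Moves G
  open Paths G

  Result : Set
  Result = (3 ≤ n × G ≅ qAdj n) ⊎ (4 ≤ n × G ≅ rAdj n)

  noThree : ¬ ThreeCycleIn
  noThree (α , α∈ , cyc) with proj₂ l≡2 α α∈ 3 cyc
  ... | s≤s (s≤s ())

  twoCycle₀ : CycleIn 2
  twoCycle₀ = proj₁ l≡2

  -- a vertex (G is nonempty, as ⟨G⟩ has a 2-cycle)
  v₀ : Fin n
  v₀ = proj₁ (proj₂ (proj₂ twoCycle₀)) #0

  module _ (m : ℕ) (q : ℕ → Fin n) (path : IsPath q m) (longest : ¬ HasPath (suc m)) where
    open LongestPath G noThree conn m q path longest

    -- A longest path is nonempty, as one-vertex paths exist.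
    1≤m : 1 ≤ m
    1≤m with m ℕ.≟ 0
    ... | no m≢0 = ≤∧≢⇒< z≤n (m≢0 ∘ ≡sym)
    ... | yes refl = ⊥-elim (longest ((λ _ → v₀) ,
            (λ i j i<1 j<1 _ → trans (n<1⇒n≡0 i<1) (≡sym (n<1⇒n≡0 j<1))) , (λ { i (s≤s ()) })))

    -- The reversed path is a longest path too; results about its far end
    -- apply to the near end of q.
    module Reversed = LongestPath G noThree conn m (rev q m) (rev-path q m path) longest

    rev-onPath : ∀ {x} → OnPath x → Reversed.OnPath x
    rev-onPath (j , j<m , e) = m ∸ suc j , rev-< m j j<m , trans (cong q (rev-rev m j j<m)) e

    rev-off : ∀ {x} → OffPath x → Reversed.OffPath x
    rev-off off i i<m = off _ (rev-< m i i<m)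

    3+[m∸3] : 3 ≤ m → m ≡ 3 + (m ∸ 3)
    3+[m∸3] 3≤m = ≡sym (m+[n∸m]≡n 3≤m)

    rev-chord : (m≡ : m ≡ 3 + (m ∸ 3)) → Chord 0 → Reversed.Chord (m ∸ 3)
    rev-chord m≡ (_ , chord) =
      subst (suc (suc (m ∸ 3)) <_) (≡sym m≡) (n<1+n _) , subst₂ (Arc G) (≡sym at2) (≡sym at0) (arc-sym chord)
      where
      at2 : rev q m (m ∸ 3) ≡ q 2
      at2 = cong q (trans (cong (_∸ suc (m ∸ 3)) m≡) (m+n∸n≡m 2 (m ∸ 3)))
      at0 : rev q m (2 + (m ∸ 3)) ≡ q 0
      at0 = cong q (trans (cong (_∸ (3 + (m ∸ 3))) m≡) (n∸n≡0 (3 + (m ∸ 3))))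

    rev-second : (m≡ : m ≡ 3 + (m ∸ 3)) → rev q m (suc (m ∸ 3)) ≡ q 1
    rev-second m≡ = cong q (trans (cong (_∸ (2 + (m ∸ 3))) m≡) (m+n∸n≡m 1 (suc (m ∸ 3))))

    -- Case 1: the path covers G.  It has a chord (else G is a path, without
    -- 2-cycles), which joins q (m-3) to q (m-1) after possibly reversing the
    -- path (else a bull appears): G ≅ Q_n.
    covering : (∀ x → OnPath x) → Result
    covering allOn with anyUpTo? chord? m
    ... | no none = ⊥-elim (Covering.chordless allOn (λ i ch → none (i , <-trans (n<2+n i) (proj₁ ch) , ch)) twoCycle₀)
    ... | yes (i , _ , ch) = chordAt i ch
      where
      chordAt : ∀ i → Chord i → Result
      chordAt i ch with m ℕ.≟ 3 + i
      ... | yes m≡ = inj₁ (Covering.isoQ allOn i m≡ ch)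
      ... | no m≢ with i
      ...   | suc i′ = ⊥-elim (bullFree i′ (≤∧≢⇒< (proj₁ ch) (m≢ ∘ ≡sym)) (proj₂ ch))
      ...   | zero = inj₁ (Reversed.Covering.isoQ (rev-onPath ∘ allOn) (m ∸ 3) m≡ (rev-chord m≡ ch))
        where
        m≡ : m ≡ 3 + (m ∸ 3)
        m≡ = 3+[m∸3] (proj₁ ch)

    -- Case 2: some vertex is off the path, reached by an arc from some q j.
    -- Then j is not an end (the path is longest); it is the second or second
    -- last vertex (else a spider appears), and after possibly reversing the
    -- path, G ≅ R_n.
    offPath : ∀ x → ¬ OnPath x → Result
    offPath x notOn with leavingArc OnPath onPath? (conn (q 0) x) (0 , 1≤m , refl) notOn
    ... | _ , b , (j , j<m , refl) , b∉ , qb = hangsAt j j<m qb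
      where
      offb : OffPath b
      offb = notOn⇒off b∉
      hangsAt : ∀ j → j < m → Arc G (q j) b → Result
      hangsAt zero _ qb = ⊥-elim (firstEnd-closed b offb qb)
      hangsAt (suc j) j<m qb with m ℕ.≟ 2 + j | m ℕ.≟ 3 + j
      ... | yes m≡ | _ = ⊥-elim (lastEnd-closed b offb (suc j) (≡sym m≡) qb)
      ... | no _ | yes m≡ = inj₂ (Pendant.isoR j m≡ b offb (arc-sym qb))
      ... | no m≢2+j | no m≢3+j with j
      ...   | suc j′ = ⊥-elim (spiderFree j′ b offb (≤∧≢⇒< (≤∧≢⇒< j<m (m≢2+j ∘ ≡sym)) (m≢3+j ∘ ≡sym))
                                 (arc-sym qb))
      ...   | zero = inj₂ (Reversed.Pendant.isoR (m ∸ 3) m≡ b (rev-off offb)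
                       (subst (Arc G b) (≡sym (rev-second m≡)) (arc-sym qb)))
        where
        m≡ : m ≡ 3 + (m ∸ 3)
        m≡ = 3+[m∸3] (≤∧≢⇒< j<m (m≢2+j ∘ ≡sym))

    classify : Result
    classify with FP.any? (λ x → ¬? (onPath? x))
    ... | yes (x , notOn) = offPath x notOn
    ... | no noneOff = covering (λ x → decidable-stable (onPath? x) (λ notOn → noneOff (x , notOn)))

  result : Result
  result with longestPath v₀
  ... | m , (q , path) , longest = classify m q path longest

proposition3p8 : (n : ℕ) (G : Graph n) → Connected G →
    (LEquals G 2 ⇔ ((3 ≤ n × G ≅ qAdj n) ⊎ (4 ≤ n × G ≅ rAdj n)))
proposition3p8 n G conn = mk⇔ (Forward.result G conn) (backward G)
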